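{- Let $a$ and $b$ be positive integers with $a\mid b$. Let $S=\{x_1,\dots,x_n\}$ with $x_1<\dots<x_n$ be a gcd-closed set of positive integers such that $\max_{x\in S}|G_S(x)|=2$ and $S$ satisfies the condition $\mathcal{G}$, and let $S_0:=S\setminus\{x_n\}=\{x_1,\dots,x_{n-1}\}$. Then $(S^b)(S^a)^{ -1}\in M_n(\mathbb{Z})\iff (S_0^b)(S_0^a)^{ -1}\in M_{n-1}(\mathbb{Z})$, $[S^b](S^a)^{ -1}\in M_n(\mathbb{Z})\iff [S_0^b](S_0^a)^{ -1}\in M_{n-1}(\mathbb{Z})$, and $[S^b][S^a]^{ -1}\in M_n(\mathbb{Z})\iff [S_0^b][S_0^a]^{ -1}\in M_{n-1}(\mathbb{Z})$.
   Context: $(x,y)$ and $[x,y]$ denote gcd and lcm. A finite set $T=\{t_1,\dots,t_m\}$ of distinct positive integers (listed increasingly) is gcd closed if $(t_i,t_j)\in T$ for all $i,j$. $(T^a)$ is the $m\times m$ matrix with $(i,j)$-entry $(t_i,t_j)^a$ and $[T^a]$ the $m\times m$ matrix with $(i,j)$-entry $[t_i,t_j]^a$ (these are invertible in the situations considered). For $x,y\in T$ with $x<y$, $x$ is a greatest-type divisor of $y$ in $T$ if $x\mid y$ and whenever $d\in T$ with $x\mid d\mid y$ then $d\in\{x,y\}$; $G_T(y)$ is the set of greatest-type divisors of $y$ in $T$. Two distinct elements $y_1,y_2\in G_T(x)$ satisfy condition $\mathcal{G}$ if $[y_1,y_2]=x$ and $(y_1,y_2)\in G_T(y_1)\cap G_T(y_2)$;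 $x$ satisfies condition $\mathcal{G}$ if any two distinct elements of $G_T(x)$ satisfy it; $T$ satisfies condition $\mathcal{G}$ if every $x\in T$ has either $|G_T(x)|\le1$, or $|G_T(x)|\ge2$ and $x$ satisfies condition $\mathcal{G}$. -}

module Defs where

open import Data.Nat as ℕ using (ℕ; zero; suc; _<_; _^_)
open import Data.Nat.Divisibility using (_∣_)
open import Data.Nat.GCD using (gcd)
open import Data.Nat.LCM using (lcm)
open import Data.Integer using (ℤ; +_)
open import Data.Rational using (ℚ; _/_; 0ℚ; 1ℚ; _+_; _*_)
open import Data.Fin using (Fin; zero; suc; inject₁)
open import Data.Product using (Σ; ∃; _×_)
open import Data.Sum using (_⊎_)
open import Relation.Binary.PropositionalEquality using (_≡_; _≢_)

Mat : ℕ → Set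
Mat n = Fin n → Fin n → ℚ

∑ : ∀ {n} → (Fin n → ℚ) → ℚ
∑ {zero}  f = 0ℚ
∑ {suc n} f = f zero + ∑ (λ i → f (suc i))

_⊗_ : ∀ {n} → Mat n → Mat n → Mat n
(A ⊗ B) i j = ∑ (λ k → A i k * B k j)

δ : ∀ {n} → Mat n
δ zero    zero    = 1ℚ
δ zero    (suc _) = 0ℚ
δ (suc _) zero    = 0ℚ
δ (suc i) (suc j) = δ i j

ℕ→ℚ : ℕ → ℚ
ℕ→ℚ m = (+ m) / 1

IsIntegral : ∀ {n} → Mat n → Set
IsIntegral {n} M = ∀ (i j : Fin n) → ∃ λ (z : ℤ) → M i j ≡ z / 1

IsInverse : ∀ {n} → Mat n → Mat n → Set
IsInverse B X = (∀ i j → (B ⊗ X) i j ≡ δ i j) × (∀ i j → (X ⊗ B) i j ≡ δ i j)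

MulInvIntegral : ∀ {n} → Mat n → Mat n → Set
MulInvIntegral A B = Σ (Mat _) λ X → IsInverse B X × IsIntegral (A ⊗ X)

-- A finite set T = {t_1 < ... < t_m} is given as a function t : Fin m → ℕ
-- (S^e) : (i,j) ↦ (t_i,t_j)^e ;  [S^e] : (i,j) ↦ [t_i,t_j]^e
gcdMat : ∀ {m} → (Fin m → ℕ) → ℕ → Mat m
gcdMat t e i j = ℕ→ℚ (gcd (t i) (t j) ^ e)

lcmMat : ∀ {m} → (Fin m → ℕ) → ℕ → Mat m
lcmMat t e i j = ℕ→ℚ (lcm (t i) (t j) ^ e)

StrictlyIncreasing : ∀ {m} → (Fin m → ℕ) → Set
StrictlyIncreasing {m} t = ∀ (i j : Fin m) → Data.Fin._<_ i j → t i < t j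

Positive : ∀ {m} → (Fin m → ℕ) → Set
Positive {m} t = ∀ (i : Fin m) → 0 < t i

GcdClosed : ∀ {m} → (Fin m → ℕ) → Set
GcdClosed {m} t = ∀ (i j : Fin m) → ∃ λ (k : Fin m) → t k ≡ gcd (t i) (t j)

IsGTD : ∀ {m} → (Fin m → ℕ) → Fin m → Fin m → Set
IsGTD {m} t i j =
  (t i < t j) × (t i ∣ t j) ×
  (∀ (k : Fin m) → t i ∣ t k → t k ∣ t j → (t k ≡ t i) ⊎ (t k ≡ t j))

GAtMostOne : ∀ {m} → (Fin m → ℕ) → Fin m → Set
GAtMostOne t j = ∀ i₁ i₂ → IsGTD t i₁ j → IsGTD t i₂ j → i₁ ≡ i₂

GAtLeastTwo : ∀ {m} → (Fin m → ℕ) → Fin m → Set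
GAtLeastTwo t j = ∃ λ i₁ → ∃ λ i₂ → (i₁ ≢ i₂) × IsGTD t i₁ j × IsGTD t i₂ j

GAtMostTwo : ∀ {m} → (Fin m → ℕ) → Fin m → Set
GAtMostTwo t j = ∀ i₁ i₂ i₃ → IsGTD t i₁ j → IsGTD t i₂ j → IsGTD t i₃ j →
  (i₁ ≡ i₂) ⊎ (i₁ ≡ i₃) ⊎ (i₂ ≡ i₃)

MaxGIsTwo : ∀ {m} → (Fin m → ℕ) → Set
MaxGIsTwo {m} t = (∀ (j : Fin m) → GAtMostTwo t j) × (∃ λ (j : Fin m) → GAtLeastTwo t j)

PairCondG : ∀ {m} → (Fin m → ℕ) → Fin m → Fin m → Fin m → Set
PairCondG {m} t j i₁ i₂ =
  (lcm (t i₁) (t i₂) ≡ t j) ×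
  (∃ λ (k : Fin m) → (t k ≡ gcd (t i₁) (t i₂)) × IsGTD t k i₁ × IsGTD t k i₂)

ElemCondG : ∀ {m} → (Fin m → ℕ) → Fin m → Set
ElemCondG t j = ∀ i₁ i₂ → i₁ ≢ i₂ → IsGTD t i₁ j → IsGTD t i₂ j → PairCondG t j i₁ i₂

SetCondG : ∀ {m} → (Fin m → ℕ) → Set
SetCondG {m} t = ∀ (j : Fin m) → GAtMostOne t j ⊎ (GAtLeastTwo t j × ElemCondG t j)

{-# OPTIONS --safe #-}
module Submission where

open import Defs
open import Data.Nat using (ℕ; suc; _<_)
open import Data.Nat.Divisibility using (_∣_)
open import Data.Fin using (Fin; inject₁)
open import Data.Product using (_×_; _,_)
open import Function.Bundles using (_⇔_; mk⇔)

-- Both sides of each equivalence hold outright, for every gcd-closed T satisfying 𝒢 with |G_T(x)| ≤ 2,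
-- and T ∖ {max T} inherits these properties.
--
-- Write μ for the Möbius function of (T, ∣) and αf(x) = Σ_{d ∣ x} μ(d, x) f(d). Gcd-closedness gives
-- Σ_{d ∣ x} μ(d, x) f((y, d)) = [x ∣ y] αf(x), i.e. (f((xᵢ, xⱼ))) = ζᵀ diag(αf) ζ with ζ the divisibility
-- matrix, so its inverse is μ diag(αf)⁻¹ μᵀ and A (f((xᵢ, xⱼ)))⁻¹ is integral as soon as αf(x) divides the
-- Möbius transform Σ_d μ(d, x) A(y, d) of every row of A. Under 𝒢 with at most two greatest-type divisors,
-- μ(·, x) lives on x and G_T(x), plus d = (y₁, y₂) when G_T(x) = {y₁, y₂}; then x = d u v, y₁ = d u,
-- y₂ = d v and α_{z^a}(x) = d^a (u^a − 1)(v^a − 1). Condition 𝒢 also pins down the cofactors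
-- [y, p] / p on these four points, so the transforms of the rows of (S^b) and [S^b] have the same shape with
-- exponent b, and u^a − 1 ∣ u^b − 1 as a ∣ b. Since [S^a] = diag(x^a) ((xᵢ, xⱼ)^{−a}) diag(x^a), the last
-- case is the same argument with f(z) = z^{−a}.

module RationalArithmetic where

  open import Data.Integer as ℤ using (ℤ; +_)
  import Data.Integer.Properties as ℤP
  open import Data.Nat as ℕ using (ℕ)
  open import Data.Integer.Divisibility.Signed using (divides) renaming (_∣_ to _∣ℤ_)
  import Data.Nat.Coprimality as Coprimality
  open import Data.Rational using (ℚ; mkℚ; _/_; 0ℚ; 1ℚ; _+_; _*_; 1/_; ≢-nonZero)
  import Data.Rational.Properties as ℚP
  open import Data.Product using (∃; _,_; proj₁)
  open import Relation.Binary.PropositionalEquality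
  open import Data.Rational.Solver using (module +-*-Solver)
  open +-*-Solver using (solve; _:*_; con; _:=_)
  open import Relation.Nullary using (yes; no; contradiction)

  ℤ→ℚ : ℤ → ℚ
  ℤ→ℚ z = z / 1

  private
    ℤ→ℚ-mkℚ : ∀ z → ℤ→ℚ z ≡ mkℚ z 0 (Coprimality.sym (Coprimality.1-coprimeTo ℤ.∣ z ∣))
    ℤ→ℚ-mkℚ z = ℚP.↥p/↧p≡p (mkℚ z 0 (Coprimality.sym (Coprimality.1-coprimeTo ℤ.∣ z ∣)))

  ℤ→ℚ-homo-+ : ∀ z w → ℤ→ℚ (z ℤ.+ w) ≡ ℤ→ℚ z + ℤ→ℚ w
  ℤ→ℚ-homo-+ z w = begin
    (z ℤ.+ w) / 1                   ≡⟨ cong₂ (λ x y → (x ℤ.+ y) / 1) (ℤP.*-identityʳ z) (ℤP.*-identityʳ w) ⟨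
    (z ℤ.* + 1 ℤ.+ w ℤ.* + 1) / 1   ≡⟨ cong₂ _+_ (ℤ→ℚ-mkℚ z) (ℤ→ℚ-mkℚ w) ⟨
    ℤ→ℚ z + ℤ→ℚ w                   ∎
    where open ≡-Reasoning

  ℤ→ℚ-homo-* : ∀ z w → ℤ→ℚ (z ℤ.* w) ≡ ℤ→ℚ z * ℤ→ℚ w
  ℤ→ℚ-homo-* z w = sym (cong₂ _*_ (ℤ→ℚ-mkℚ z) (ℤ→ℚ-mkℚ w))

  ℤ→ℚ-injective : ∀ {z w} → ℤ→ℚ z ≡ ℤ→ℚ w → z ≡ w
  ℤ→ℚ-injective {z} {w} eq = proj₁ (ℚP.mkℚ-injective (trans (sym (ℤ→ℚ-mkℚ z)) (trans eq (ℤ→ℚ-mkℚ w))))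

  ℤ→ℚ-nonZero : ∀ {z} → z ≢ + 0 → ℤ→ℚ z ≢ 0ℚ
  ℤ→ℚ-nonZero z≢0 eq = z≢0 (ℤ→ℚ-injective eq)

  IsInteger : ℚ → Set
  IsInteger q = ∃ λ z → q ≡ ℤ→ℚ z

  isInteger-ℤ→ℚ : ∀ z → IsInteger (ℤ→ℚ z)
  isInteger-ℤ→ℚ z = z , refl

  isInteger-+ : ∀ {p q} → IsInteger p → IsInteger q → IsInteger (p + q)
  isInteger-+ (z , refl) (w , refl) = z ℤ.+ w , sym (ℤ→ℚ-homo-+ z w)

  isInteger-* : ∀ {p q} → IsInteger p → IsInteger q → IsInteger (p * q)
  isInteger-* (z , refl) (w , refl) = z ℤ.* w , sym (ℤ→ℚ-homo-* z w)

  -- A total inverse: 0ℚ ⁻¹ = 0ℚ.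
  infix 9 _⁻¹
  _⁻¹ : ℚ → ℚ
  p ⁻¹ with p ℚP.≟ 0ℚ
  ... | yes _   = 0ℚ
  ... | no p≢0 = (1/ p) {{≢-nonZero p≢0}}

  ⁻¹-inverseʳ : ∀ {p} → p ≢ 0ℚ → p * p ⁻¹ ≡ 1ℚ
  ⁻¹-inverseʳ {p} p≢0 with p ℚP.≟ 0ℚ
  ... | yes p≡0  = contradiction p≡0 p≢0
  ... | no  p≢0′ = ℚP.*-inverseʳ p {{≢-nonZero p≢0′}}

  *-nonZero : ∀ {p q} → p ≢ 0ℚ → q ≢ 0ℚ → p * q ≢ 0ℚ
  *-nonZero {p} {q} p≢0 q≢0 pq≡0 = ℚP.1≢0 (begin
    1ℚ                            ≡⟨ cong₂ _*_ (⁻¹-inverseʳ p≢0) (⁻¹-inverseʳ q≢0) ⟨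
    p * p ⁻¹ * (q * q ⁻¹)         ≡⟨ regroup p q (p ⁻¹) (q ⁻¹) ⟩
    p * q * (p ⁻¹ * q ⁻¹)         ≡⟨ cong (_* (p ⁻¹ * q ⁻¹)) pq≡0 ⟩
    0ℚ * (p ⁻¹ * q ⁻¹)            ≡⟨ ℚP.*-zeroˡ (p ⁻¹ * q ⁻¹) ⟩
    0ℚ                            ∎)
    where
    open ≡-Reasoning
    regroup : ∀ a b c d → a * c * (b * d) ≡ a * b * (c * d)
    regroup = solve 4 (λ a b c d → a :* c :* (b :* d) := a :* b :* (c :* d)) refl

  ⁻¹-distrib-* : ∀ {p q} → p ≢ 0ℚ → q ≢ 0ℚ → (p * q) ⁻¹ ≡ p ⁻¹ * q ⁻¹
  ⁻¹-distrib-* {p} {q} p≢0 q≢0 = begin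
    (p * q) ⁻¹                                ≡⟨ ℚP.*-identityʳ _ ⟨
    (p * q) ⁻¹ * 1ℚ                           ≡⟨ cong ((p * q) ⁻¹ *_) (cong₂ _*_ (⁻¹-inverseʳ p≢0) (⁻¹-inverseʳ q≢0)) ⟨
    (p * q) ⁻¹ * (p * p ⁻¹ * (q * q ⁻¹))      ≡⟨ regroup ((p * q) ⁻¹) p q (p ⁻¹) (q ⁻¹) ⟩
    (p * q * (p * q) ⁻¹) * (p ⁻¹ * q ⁻¹)      ≡⟨ cong (_* (p ⁻¹ * q ⁻¹)) (⁻¹-inverseʳ (*-nonZero p≢0 q≢0)) ⟩
    1ℚ * (p ⁻¹ * q ⁻¹)                        ≡⟨ ℚP.*-identityˡ _ ⟩
    p ⁻¹ * q ⁻¹                               ∎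
    where
    open ≡-Reasoning
    regroup : ∀ r a b c d → r * (a * c * (b * d)) ≡ (a * b * r) * (c * d)
    regroup = solve 5 (λ r a b c d → r :* (a :* c :* (b :* d)) := (a :* b :* r) :* (c :* d)) refl

  ℤ→ℚ-÷ : ∀ {n d} q → d ≢ + 0 → n ≡ q ℤ.* d → ℤ→ℚ n * (ℤ→ℚ d) ⁻¹ ≡ ℤ→ℚ q
  ℤ→ℚ-÷ {n} {d} q d≢0 refl = begin
    ℤ→ℚ (q ℤ.* d) * D ⁻¹   ≡⟨ cong (_* D ⁻¹) (ℤ→ℚ-homo-* q d) ⟩
    ℤ→ℚ q * D * D ⁻¹       ≡⟨ ℚP.*-assoc (ℤ→ℚ q) D (D ⁻¹) ⟩
    ℤ→ℚ q * (D * D ⁻¹)     ≡⟨ cong (ℤ→ℚ q *_) (⁻¹-inverseʳ (ℤ→ℚ-nonZero d≢0)) ⟩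
    ℤ→ℚ q * 1ℚ             ≡⟨ ℚP.*-identityʳ (ℤ→ℚ q) ⟩
    ℤ→ℚ q                  ∎
    where
    open ≡-Reasoning
    D = ℤ→ℚ d

  isInteger-÷ : ∀ {n d} → d ≢ + 0 → d ∣ℤ n → IsInteger (ℤ→ℚ n * (ℤ→ℚ d) ⁻¹)
  isInteger-÷ d≢0 (divides q n≡qd) = q , ℤ→ℚ-÷ q d≢0 n≡qd

  ℕ→ℚ-homo-* : ∀ m n → ℕ→ℚ (m ℕ.* n) ≡ ℕ→ℚ m * ℕ→ℚ n
  ℕ→ℚ-homo-* m n = trans (cong ℤ→ℚ (ℤP.pos-* m n)) (ℤ→ℚ-homo-* (+ m) (+ n))

open RationalArithmetic

module Matrices where

  open import Data.Nat using (zero; suc)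
  open import Data.Fin as F using (Fin; zero; suc)
  open import Data.Fin.Properties using (<-cmp; suc-injective)
  open import Data.Fin.Induction using (<-wellFounded)
  open import Data.Rational using (ℚ; 0ℚ; 1ℚ; _+_; _*_; _-_; -_)
  import Data.Rational.Properties as ℚP
  open import Induction.WellFounded using (Acc; acc)
  open import Algebra.Bundles using (CommutativeRing)
  open import Relation.Binary.Definitions using (tri<; tri≈; tri>)
  open import Relation.Binary.PropositionalEquality
  open import Data.Rational.Solver using (module +-*-Solver)
  open +-*-Solver using (solve; _:+_; _:-_; con; _:=_)
  open import Relation.Nullary using (contradiction)
  open import Function using (_∘_)
  open import Data.Integer using (0ℤ; 1ℤ)
  open import Algebra.Properties.Semiring.Sum (CommutativeRing.semiring ℚP.+-*-commutativeRing) as Sum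
    using (sum; sum-cong-≗)

  ∑≡sum : ∀ {n} (f : Fin n → ℚ) → ∑ f ≡ sum f
  ∑≡sum {zero}  f = refl
  ∑≡sum {suc n} f = cong (f zero +_) (∑≡sum (λ i → f (suc i)))

  ∑-cong : ∀ {n} {f g : Fin n → ℚ} → (∀ i → f i ≡ g i) → ∑ f ≡ ∑ g
  ∑-cong {f = f} {g} f≗g = trans (∑≡sum f) (trans (sum-cong-≗ f≗g) (sym (∑≡sum g)))

  ∑-zero : ∀ {n} {f : Fin n → ℚ} → (∀ i → f i ≡ 0ℚ) → ∑ f ≡ 0ℚ
  ∑-zero {n} f≗0 = trans (∑-cong f≗0) (trans (∑≡sum {n} (λ _ → 0ℚ)) (Sum.sum-replicate-zero n))

  ∑-distrib-+ : ∀ {n} (f g : Fin n → ℚ) → ∑ (λ i → f i + g i) ≡ ∑ f + ∑ g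
  ∑-distrib-+ f g = trans (∑≡sum (λ i → f i + g i)) (trans (Sum.∑-distrib-+ f g) (sym (cong₂ _+_ (∑≡sum f) (∑≡sum g))))

  ∑-distrib-- : ∀ {n} (f g : Fin n → ℚ) → ∑ (λ i → f i - g i) ≡ ∑ f - ∑ g
  ∑-distrib-- {zero}  f g = refl
  ∑-distrib-- {suc n} f g = trans (cong (f zero - g zero +_) (∑-distrib-- (λ i → f (suc i)) (λ i → g (suc i))))
                                  (regroup (f zero) (g zero) _ _)
    where
    regroup : ∀ a b c d → a - b + (c - d) ≡ a + c - (b + d)
    regroup = solve 4 (λ a b c d → a :- b :+ (c :- d) := a :+ c :- (b :+ d)) refl

  *-distribˡ-∑ : ∀ {n} x (f : Fin n → ℚ) → x * ∑ f ≡ ∑ (λ i → x * f i)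
  *-distribˡ-∑ x f = trans (cong (x *_) (∑≡sum f)) (trans (Sum.*-distribˡ-sum x f) (sym (∑≡sum (λ i → x * f i))))

  *-distribʳ-∑ : ∀ {n} x (f : Fin n → ℚ) → ∑ f * x ≡ ∑ (λ i → f i * x)
  *-distribʳ-∑ x f = trans (cong (_* x) (∑≡sum f)) (trans (Sum.*-distribʳ-sum x f) (sym (∑≡sum (λ i → f i * x))))

  ∑-comm : ∀ {m n} (f : Fin m → Fin n → ℚ) → ∑ (λ i → ∑ (f i)) ≡ ∑ (λ j → ∑ (λ i → f i j))
  ∑-comm f = trans (∑∑≡sumsum f) (trans (Sum.∑-comm f) (sym (∑∑≡sumsum (λ j i → f i j))))
    where
    ∑∑≡sumsum : ∀ {m n} (f : Fin m → Fin n → ℚ) → ∑ (λ i → ∑ (f i)) ≡ sum (λ i → sum (f i))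
    ∑∑≡sumsum f = trans (∑≡sum (λ i → ∑ (f i))) (sum-cong-≗ (λ i → ∑≡sum (f i)))

  ∑-single : ∀ {n} (f : Fin n → ℚ) l → (∀ k → k ≢ l → f k ≡ 0ℚ) → ∑ f ≡ f l
  ∑-single f zero    f≡0 = trans (cong (f zero +_) (∑-zero (λ k → f≡0 (suc k) λ ()))) (ℚP.+-identityʳ (f zero))
  ∑-single f (suc l) f≡0 =
    trans (cong₂ _+_ (f≡0 zero λ ()) (∑-single (λ k → f (suc k)) l (λ k k≢l → f≡0 (suc k) (k≢l ∘ suc-injective))))
          (ℚP.+-identityˡ (f (suc l)))

  isInteger-∑ : ∀ {n} {f : Fin n → ℚ} → (∀ i → IsInteger (f i)) → IsInteger (∑ f)
  isInteger-∑ {zero}  _    = isInteger-ℤ→ℚ 0ℤ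
  isInteger-∑ {suc n} isInt = isInteger-+ (isInt zero) (isInteger-∑ (λ i → isInt (suc i)))

  δ-diag : ∀ {n} (i : Fin n) → δ i i ≡ 1ℚ
  δ-diag zero    = refl
  δ-diag (suc i) = δ-diag i

  δ-≢ : ∀ {n} (i j : Fin n) → i ≢ j → δ i j ≡ 0ℚ
  δ-≢ zero    zero    i≢j = contradiction refl i≢j
  δ-≢ zero    (suc j) _   = refl
  δ-≢ (suc i) zero    _   = refl
  δ-≢ (suc i) (suc j) i≢j = δ-≢ i j (i≢j ∘ cong suc)

  δ-sym : ∀ {n} (i j : Fin n) → δ i j ≡ δ j i
  δ-sym zero    zero    = refl
  δ-sym zero    (suc j) = refl
  δ-sym (suc i) zero    = refl
  δ-sym (suc i) (suc j) = δ-sym i j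

  isInteger-δ : ∀ {n} (i j : Fin n) → IsInteger (δ i j)
  isInteger-δ zero    zero    = isInteger-ℤ→ℚ 1ℤ
  isInteger-δ zero    (suc j) = isInteger-ℤ→ℚ 0ℤ
  isInteger-δ (suc i) zero    = isInteger-ℤ→ℚ 0ℤ
  isInteger-δ (suc i) (suc j) = isInteger-δ i j

  ∑-δʳ : ∀ {n} (g : Fin n → ℚ) p → ∑ (λ k → g k * δ k p) ≡ g p
  ∑-δʳ g p = trans (∑-single (λ k → g k * δ k p) p (λ k k≢p → trans (cong (g k *_) (δ-≢ k p k≢p)) (ℚP.*-zeroʳ (g k))))
                   (trans (cong (g p *_) (δ-diag p)) (ℚP.*-identityʳ (g p)))

  ⊗-identityʳ : ∀ {n} (A : Mat n) i j → (A ⊗ δ) i j ≡ A i j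
  ⊗-identityʳ A i = ∑-δʳ (A i)

  ⊗-identityˡ : ∀ {n} (A : Mat n) i j → (δ ⊗ A) i j ≡ A i j
  ⊗-identityˡ A i j = trans (∑-cong (λ k → trans (ℚP.*-comm (δ i k) (A k j)) (cong (A k j *_) (δ-sym i k))))
                            (∑-δʳ (λ k → A k j) i)

  ⊗-assoc : ∀ {n} (A B C : Mat n) i j → ((A ⊗ B) ⊗ C) i j ≡ (A ⊗ (B ⊗ C)) i j
  ⊗-assoc A B C i j = begin
    ∑ (λ k → ∑ (λ l → A i l * B l k) * C k j)      ≡⟨ ∑-cong (λ k → *-distribʳ-∑ (C k j) (λ l → A i l * B l k)) ⟩
    ∑ (λ k → ∑ (λ l → A i l * B l k * C k j))      ≡⟨ ∑-comm (λ k l → A i l * B l k * C k j) ⟩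
    ∑ (λ l → ∑ (λ k → A i l * B l k * C k j))      ≡⟨ ∑-cong (λ l → ∑-cong (λ k → ℚP.*-assoc (A i l) (B l k) (C k j))) ⟩
    ∑ (λ l → ∑ (λ k → A i l * (B l k * C k j)))    ≡⟨ ∑-cong (λ l → *-distribˡ-∑ (A i l) (λ k → B l k * C k j)) ⟨
    ∑ (λ l → A i l * ∑ (λ k → B l k * C k j))      ∎
    where open ≡-Reasoning

  record UpperUnitriangular {n} (M : Mat n) : Set where
    field
      diagonal       : ∀ k → M k k ≡ 1ℚ
      below-diagonal : ∀ k l → l F.< k → M k l ≡ 0ℚ

  module _ {n} {M : Mat n} (M-unitriangular : UpperUnitriangular M) where

    open UpperUnitriangular M-unitriangular

    ⊗-unitriangular-cancel : ∀ {N : Mat n} → (∀ i l → (N ⊗ M) i l ≡ 0ℚ) → ∀ i l → N i l ≡ 0ℚ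
    ⊗-unitriangular-cancel {N} NM≡0 i l = column (<-wellFounded l)
      where
      column : ∀ {l} → Acc F._<_ l → N i l ≡ 0ℚ
      column {l} (acc rec) = begin
        N i l              ≡⟨ ℚP.*-identityʳ (N i l) ⟨
        N i l * 1ℚ         ≡⟨ cong (N i l *_) (diagonal l) ⟨
        N i l * M l l      ≡⟨ ∑-single (λ k → N i k * M k l) l off-diagonal ⟨
        (N ⊗ M) i l        ≡⟨ NM≡0 i l ⟩
        0ℚ                 ∎
        where
        open ≡-Reasoning
        off-diagonal : ∀ k → k ≢ l → N i k * M k l ≡ 0ℚ
        off-diagonal k k≢l with <-cmp k l
        ... | tri< k<l _ _ = trans (cong (_* M k l) (column (rec k<l))) (ℚP.*-zeroˡ (M k l))
        ... | tri≈ _ k≡l _ = contradiction k≡l k≢l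
        ... | tri> _ _ l<k = trans (cong (N i k *_) (below-diagonal k l l<k)) (ℚP.*-zeroʳ (N i k))

    leftInverse⇒rightInverse : ∀ {Z : Mat n} → (∀ i j → (Z ⊗ M) i j ≡ δ i j) → ∀ i j → (M ⊗ Z) i j ≡ δ i j
    leftInverse⇒rightInverse {Z} ZM≡δ i j = begin
      (M ⊗ Z) i j                   ≡⟨ split ((M ⊗ Z) i j) (δ i j) ⟩
      (M ⊗ Z) i j - δ i j + δ i j   ≡⟨ cong (_+ δ i j) (⊗-unitriangular-cancel {N} NM≡0 i j) ⟩
      0ℚ + δ i j                    ≡⟨ ℚP.+-identityˡ (δ i j) ⟩
      δ i j                         ∎
      where
      open ≡-Reasoning
      split : ∀ x d → x ≡ x - d + d
      split = solve 2 (λ x d → x := x :- d :+ d) refl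
      N : Mat n
      N i j = (M ⊗ Z) i j - δ i j
      NM≡0 : ∀ i l → (N ⊗ M) i l ≡ 0ℚ
      NM≡0 i l = begin
        ∑ (λ k → ((M ⊗ Z) i k - δ i k) * M k l)                ≡⟨ ∑-cong (λ k → ℚP.*-distribʳ-+ (M k l) ((M ⊗ Z) i k) (- δ i k)) ⟩
        ∑ (λ k → (M ⊗ Z) i k * M k l + - δ i k * M k l)        ≡⟨ ∑-cong (λ k → cong ((M ⊗ Z) i k * M k l +_) (sym (ℚP.neg-distribˡ-* (δ i k) (M k l)))) ⟩
        ∑ (λ k → (M ⊗ Z) i k * M k l - δ i k * M k l)          ≡⟨ ∑-distrib-- (λ k → (M ⊗ Z) i k * M k l) (λ k → δ i k * M k l) ⟩
        ((M ⊗ Z) ⊗ M) i l - (δ ⊗ M) i l                       ≡⟨ cong₂ _-_ (⊗-assoc M Z M i l) (⊗-identityˡ M i l) ⟩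
        (M ⊗ (Z ⊗ M)) i l - M i l                             ≡⟨ cong (_- M i l) (trans (∑-cong (λ k → cong (M i k *_) (ZM≡δ k l))) (⊗-identityʳ M i l)) ⟩
        M i l - M i l                                          ≡⟨ ℚP.+-inverseʳ (M i l) ⟩
        0ℚ                                                     ∎

open Matrices

module NaturalArithmetic where

  open import Data.Nat using (ℕ; zero; suc; _+_; _*_; _^_; _≤_; _∸_; NonZero)
  import Data.Nat.Properties as ℕP
  open import Data.Nat.Divisibility using (_∣_; divides; ∣-refl; ∣-trans; ∣-antisym; *-pres-∣)
  open import Data.Nat.GCD using (gcd; gcd[m,n]∣m; gcd[m,n]∣n; gcd-greatest)
  open import Data.Nat.LCM using (lcm; m∣lcm[m,n]; n∣lcm[m,n]; lcm-least; gcd*lcm)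
  open import Data.Nat.Tactic.RingSolver using () renaming (solve-∀ to ℕ-solve-∀)
  open import Relation.Binary.PropositionalEquality
  open import Data.Fin using (Fin)
  import Data.Fin.Properties as FP
  open import Relation.Binary.Definitions using (tri<; tri≈; tri>)
  open import Relation.Nullary using (contradiction)

  ^-distribʳ-* : ∀ m n k → (m * n) ^ k ≡ m ^ k * n ^ k
  ^-distribʳ-* m n zero    = refl
  ^-distribʳ-* m n (suc k) = trans (cong (m * n *_) (^-distribʳ-* m n k)) (regroup m n (m ^ k) (n ^ k))
    where
    regroup : ∀ m n x y → m * n * (x * y) ≡ m * x * (n * y)
    regroup = ℕ-solve-∀

  ^-monoʳ-∣ : ∀ n {a b} → a ≤ b → n ^ a ∣ n ^ b
  ^-monoʳ-∣ n {a} {b} a≤b = divides (n ^ (b ∸ a)) (begin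
    n ^ b                ≡⟨ cong (n ^_) (ℕP.m+[n∸m]≡n a≤b) ⟨
    n ^ (a + (b ∸ a))    ≡⟨ ℕP.^-distribˡ-+-* n a (b ∸ a) ⟩
    n ^ a * n ^ (b ∸ a)  ≡⟨ ℕP.*-comm (n ^ a) (n ^ (b ∸ a)) ⟩
    n ^ (b ∸ a) * n ^ a  ∎)
    where open ≡-Reasoning

  ^-monoˡ-∣ : ∀ {m n} k → m ∣ n → m ^ k ∣ n ^ k
  ^-monoˡ-∣ zero    m∣n = ∣-refl
  ^-monoˡ-∣ (suc k) m∣n = *-pres-∣ m∣n (^-monoˡ-∣ k m∣n)

  ∣m∣n⇒∣m∸n : ∀ {d m n} → d ∣ m → d ∣ n → d ∣ m ∸ n
  ∣m∣n⇒∣m∸n {d} (divides p refl) (divides q refl) = divides (p ∸ q) (sym (ℕP.*-distribʳ-∸ d p q))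

  gcd-of-divisor : ∀ {d n} → d ∣ n → gcd n d ≡ d
  gcd-of-divisor {d} {n} d∣n = ∣-antisym (gcd[m,n]∣n n d) (gcd-greatest d∣n ∣-refl)

  lcm-of-divisor : ∀ {d n} → d ∣ n → lcm n d ≡ n
  lcm-of-divisor {d} {n} d∣n = ∣-antisym (lcm-least ∣-refl d∣n) (m∣lcm[m,n] n d)

  gcd-sandwich : ∀ a {l p} → p ∣ l → gcd a l ∣ p → gcd a l ≡ gcd a p
  gcd-sandwich a {l} {p} p∣l gcd∣p = ∣-antisym
    (gcd-greatest (gcd[m,n]∣m a l) gcd∣p)
    (gcd-greatest (gcd[m,n]∣m a p) (∣-trans (gcd[m,n]∣n a p) p∣l))

  lcm-absorb : ∀ {g x} y → g ∣ x → lcm x (lcm g y) ≡ lcm x y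
  lcm-absorb {g} {x} y g∣x = ∣-antisym
    (lcm-least (m∣lcm[m,n] x y) (lcm-least (∣-trans g∣x (m∣lcm[m,n] x y)) (n∣lcm[m,n] x y)))
    (lcm-least (m∣lcm[m,n] x (lcm g y)) (∣-trans (n∣lcm[m,n] g y) (n∣lcm[m,n] x (lcm g y))))

  lcm-cofactor : ∀ {x y g} c .{{_ : NonZero g}} → gcd x y ≡ g → x ≡ c * g → lcm x y ≡ c * y
  lcm-cofactor {x} {y} {g} c gcd≡g x≡cg = ℕP.*-cancelˡ-≡ (lcm x y) (c * y) g (begin
    g * lcm x y          ≡⟨ cong (_* lcm x y) gcd≡g ⟨
    gcd x y * lcm x y    ≡⟨ gcd*lcm x y ⟩
    x * y                ≡⟨ cong (_* y) x≡cg ⟩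
    c * g * y            ≡⟨ regroup c g y ⟩
    g * (c * y)          ∎)
    where
    open ≡-Reasoning
    regroup : ∀ c g y → c * g * y ≡ g * (c * y)
    regroup = ℕ-solve-∀

  gcd-sandwich₂ : ∀ a {l p q} → q ∣ l → gcd a l ∣ p → gcd a q ≡ gcd a (gcd p q)
  gcd-sandwich₂ a {l} {p} {q} q∣l gcd∣p = gcd-sandwich a (gcd[m,n]∣n p q)
    (gcd-greatest (∣-trans (gcd-greatest (gcd[m,n]∣m a q) (∣-trans (gcd[m,n]∣n a q) q∣l)) gcd∣p) (gcd[m,n]∣n a q))

  strictlyIncreasing⇒injective : ∀ {m} {t : Fin m → ℕ} → StrictlyIncreasing t → ∀ {i j} → t i ≡ t j → i ≡ j
  strictlyIncreasing⇒injective t-inc {i} {j} tᵢ≡tⱼ with FP.<-cmp i j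
  ... | tri< i<j _ _ = contradiction tᵢ≡tⱼ (ℕP.<⇒≢ (t-inc i j i<j))
  ... | tri≈ _ i≡j _ = i≡j
  ... | tri> _ _ j<i = contradiction (sym tᵢ≡tⱼ) (ℕP.<⇒≢ (t-inc j i j<i))

open NaturalArithmetic

module IntegerDivisibility where

  open import Data.Nat as ℕ using (ℕ; zero; suc; _<_)
  import Data.Nat.Properties as ℕP
  import Data.Nat.Divisibility as ℕ
  open import Data.Integer using (+_; 0ℤ; 1ℤ; _+_; _-_; _*_)
  import Data.Integer.Properties as ℤP
  open import Data.Integer.Divisibility.Signed renaming (_∣_ to _∣ℤ_)
  open import Data.Integer.Tactic.RingSolver using () renaming (solve-∀ to ℤ-solve-∀)
  open import Relation.Binary.PropositionalEquality
  open import Data.Sum using (inj₁; inj₂)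

  +≢0 : ∀ {n} → 0 < n → + n ≢ 0ℤ
  +≢0 {suc n} _ ()

  +-1≢0 : ∀ {n} → 1 < n → + n - 1ℤ ≢ 0ℤ
  +-1≢0 {suc zero}    (ℕ.s≤s ())
  +-1≢0 {suc (suc n)} _ ()

  *-≢0 : ∀ {i j} → i ≢ 0ℤ → j ≢ 0ℤ → i * j ≢ 0ℤ
  *-≢0 {i} i≢0 j≢0 ij≡0 with ℤP.i*j≡0⇒i≡0∨j≡0 i ij≡0
  ... | inj₁ i≡0 = i≢0 i≡0
  ... | inj₂ j≡0 = j≢0 j≡0

  pos-∣ : ∀ {m n} → m ℕ.∣ n → + m ∣ℤ + n
  pos-∣ = ∣ᵤ⇒∣

  *-pres-∣ : ∀ {a b c d} → a ∣ℤ b → c ∣ℤ d → a * c ∣ℤ b * d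
  *-pres-∣ {a} {b} {c} {d} a∣b c∣d = ∣-trans (*-monoʳ-∣ a c∣d) (*-monoˡ-∣ d a∣b)

  [x^a-1]∣[x^ka-1] : ∀ x a k → + (x ℕ.^ a) - 1ℤ ∣ℤ + (x ℕ.^ (k ℕ.* a)) - 1ℤ
  [x^a-1]∣[x^ka-1] x a zero    = divides 0ℤ refl
  [x^a-1]∣[x^ka-1] x a (suc k) = subst (+ (x ℕ.^ a) - 1ℤ ∣ℤ_) (sym expand)
    (∣m∣n⇒∣m+n (∣n⇒∣m*n (+ (x ℕ.^ a)) ([x^a-1]∣[x^ka-1] x a k)) ∣-refl)
    where
    open ≡-Reasoning
    regroup : ∀ y z → y * z - 1ℤ ≡ y * (z - 1ℤ) + (y - 1ℤ)
    regroup = ℤ-solve-∀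
    expand : + (x ℕ.^ (a ℕ.+ k ℕ.* a)) - 1ℤ ≡ + (x ℕ.^ a) * (+ (x ℕ.^ (k ℕ.* a)) - 1ℤ) + (+ (x ℕ.^ a) - 1ℤ)
    expand = begin
      + (x ℕ.^ (a ℕ.+ k ℕ.* a)) - 1ℤ                  ≡⟨ cong (λ n → + n - 1ℤ) (ℕP.^-distribˡ-+-* x a (k ℕ.* a)) ⟩
      + (x ℕ.^ a ℕ.* x ℕ.^ (k ℕ.* a)) - 1ℤ            ≡⟨ cong (_- 1ℤ) (ℤP.pos-* (x ℕ.^ a) (x ℕ.^ (k ℕ.* a))) ⟩
      + (x ℕ.^ a) * + (x ℕ.^ (k ℕ.* a)) - 1ℤ          ≡⟨ regroup (+ (x ℕ.^ a)) (+ (x ℕ.^ (k ℕ.* a))) ⟩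
      + (x ℕ.^ a) * (+ (x ℕ.^ (k ℕ.* a)) - 1ℤ) + (+ (x ℕ.^ a) - 1ℤ) ∎

  [x^a-1]∣[x^m-x^n] : ∀ x {a m n} → a ℕ.∣ m → a ℕ.∣ n → + (x ℕ.^ a) - 1ℤ ∣ℤ + (x ℕ.^ m) - + (x ℕ.^ n)
  [x^a-1]∣[x^m-x^n] x {a} (ℕ.divides i refl) (ℕ.divides j refl) =
    subst (+ (x ℕ.^ a) - 1ℤ ∣ℤ_) (difference (+ (x ℕ.^ (i ℕ.* a))) (+ (x ℕ.^ (j ℕ.* a))))
      (∣m∣n⇒∣m-n ([x^a-1]∣[x^ka-1] x a i) ([x^a-1]∣[x^ka-1] x a j))
    where
    difference : ∀ y z → y - 1ℤ - (z - 1ℤ) ≡ y - z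
    difference = ℤ-solve-∀

open IntegerDivisibility

module Combinations where

  open import Data.Nat using (ℕ; _<_)
  open import Data.Nat.Divisibility using (_∣_; _∣?_; ∣-refl; ∣-trans)
  open import Data.Nat.GCD using (gcd; gcd[m,n]∣n; gcd-greatest)
  import Data.Nat.Properties
  open import Data.Integer as ℤ using (ℤ; 0ℤ; 1ℤ; -1ℤ)
  open import Data.Fin using (Fin)
  import Data.Fin.Properties
  open import Data.Rational using (ℚ; 0ℚ; 1ℚ; _+_; _*_; _-_)
  import Data.Rational.Properties as ℚP
  open import Data.Bool using (if_then_else_)
  open import Data.List using (List; []; _∷_)
  open import Data.List.Relation.Unary.All using (All; []; _∷_)
  open import Data.Product using (_×_; _,_; proj₂)
  open import Data.Sum using (_⊎_; inj₁; inj₂)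
  open import Function using (_∘_)
  open import Relation.Binary.PropositionalEquality
  open import Data.Rational.Solver using (module +-*-Solver)
  open +-*-Solver using (solve; _:+_; _:*_; _:-_; con; _:=_)
  open import Relation.Nullary using (¬_; does; yes; no)
  open import Relation.Nullary.Decidable using (dec-true; dec-false)
  open import Data.Integer.Tactic.RingSolver using () renaming (solve-∀ to ℤ-solve-∀)

  Combination : ℕ → Set
  Combination m = List (ℤ × Fin m)

  ⟪_∣_⟫ : ∀ {m} → Combination m → (Fin m → ℚ) → ℚ
  ⟪ []           ∣ g ⟫ = 0ℚ
  ⟪ (c , p) ∷ cs ∣ g ⟫ = ℤ→ℚ c * g p + ⟪ cs ∣ g ⟫

  ⟪_∣_⟫ℤ : ∀ {m} → Combination m → (Fin m → ℤ) → ℤ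
  ⟪ []           ∣ G ⟫ℤ = 0ℤ
  ⟪ (c , p) ∷ cs ∣ G ⟫ℤ = c ℤ.* G p ℤ.+ ⟪ cs ∣ G ⟫ℤ

  module _ {m : ℕ} where

    ⟪∣⟫-cong : ∀ {P : Fin m → Set} {g h : Fin m → ℚ} cs → All (P ∘ proj₂) cs →
               (∀ p → P p → g p ≡ h p) → ⟪ cs ∣ g ⟫ ≡ ⟪ cs ∣ h ⟫
    ⟪∣⟫-cong []             []         g≡h = refl
    ⟪∣⟫-cong ((c , p) ∷ cs) (Pp ∷ Pcs) g≡h = cong₂ (λ x y → ℤ→ℚ c * x + y) (g≡h p Pp) (⟪∣⟫-cong cs Pcs g≡h)

    ⟪∣⟫ℤ-cong : ∀ {P : Fin m → Set} {G H : Fin m → ℤ} cs → All (P ∘ proj₂) cs →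
                (∀ p → P p → G p ≡ H p) → ⟪ cs ∣ G ⟫ℤ ≡ ⟪ cs ∣ H ⟫ℤ
    ⟪∣⟫ℤ-cong []             []         G≡H = refl
    ⟪∣⟫ℤ-cong ((c , p) ∷ cs) (Pp ∷ Pcs) G≡H = cong₂ (λ x y → c ℤ.* x ℤ.+ y) (G≡H p Pp) (⟪∣⟫ℤ-cong cs Pcs G≡H)

    ⟪∣⟫-zero : ∀ {P : Fin m → Set} {g : Fin m → ℚ} cs → All (P ∘ proj₂) cs →
               (∀ p → P p → g p ≡ 0ℚ) → ⟪ cs ∣ g ⟫ ≡ 0ℚ
    ⟪∣⟫-zero []             []         g≡0 = refl
    ⟪∣⟫-zero ((c , p) ∷ cs) (Pp ∷ Pcs) g≡0 = begin
      ℤ→ℚ c * _ + ⟪ cs ∣ _ ⟫  ≡⟨ cong₂ (λ x y → ℤ→ℚ c * x + y) (g≡0 p Pp) (⟪∣⟫-zero cs Pcs g≡0) ⟩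
      ℤ→ℚ c * 0ℚ + 0ℚ        ≡⟨ cong (_+ 0ℚ) (ℚP.*-zeroʳ (ℤ→ℚ c)) ⟩
      0ℚ                     ∎
      where open ≡-Reasoning

    ⟪∣⟫-*ˡ : ∀ x (g : Fin m → ℚ) cs → ⟪ cs ∣ (λ p → x * g p) ⟫ ≡ x * ⟪ cs ∣ g ⟫
    ⟪∣⟫-*ˡ x g []             = sym (ℚP.*-zeroʳ x)
    ⟪∣⟫-*ˡ x g ((c , p) ∷ cs) = trans (cong (ℤ→ℚ c * (x * g p) +_) (⟪∣⟫-*ˡ x g cs)) (pull (ℤ→ℚ c) x (g p) _)
      where
      pull : ∀ c x y s → c * (x * y) + x * s ≡ x * (c * y + s)
      pull = solve 4 (λ c x y s → c :* (x :* y) :+ x :* s := x :* (c :* y :+ s)) refl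

    ⟪∣⟫-*ʳ : ∀ (g : Fin m → ℚ) x cs → ⟪ cs ∣ (λ p → g p * x) ⟫ ≡ ⟪ cs ∣ g ⟫ * x
    ⟪∣⟫-*ʳ g x []             = sym (ℚP.*-zeroˡ x)
    ⟪∣⟫-*ʳ g x ((c , p) ∷ cs) = trans (cong (ℤ→ℚ c * (g p * x) +_) (⟪∣⟫-*ʳ g x cs)) (pull (ℤ→ℚ c) (g p) x _)
      where
      pull : ∀ c y x s → c * (y * x) + s * x ≡ (c * y + s) * x
      pull = solve 4 (λ c y x s → c :* (y :* x) :+ s :* x := (c :* y :+ s) :* x) refl

    ⟪∣⟫-ℤ→ℚ : ∀ (G : Fin m → ℤ) cs → ⟪ cs ∣ ℤ→ℚ ∘ G ⟫ ≡ ℤ→ℚ ⟪ cs ∣ G ⟫ℤ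
    ⟪∣⟫-ℤ→ℚ G []             = refl
    ⟪∣⟫-ℤ→ℚ G ((c , p) ∷ cs) = begin
      ℤ→ℚ c * ℤ→ℚ (G p) + ⟪ cs ∣ ℤ→ℚ ∘ G ⟫       ≡⟨ cong₂ _+_ (sym (ℤ→ℚ-homo-* c (G p))) (⟪∣⟫-ℤ→ℚ G cs) ⟩
      ℤ→ℚ (c ℤ.* G p) + ℤ→ℚ ⟪ cs ∣ G ⟫ℤ          ≡⟨ ℤ→ℚ-homo-+ (c ℤ.* G p) ⟪ cs ∣ G ⟫ℤ ⟨
      ℤ→ℚ (c ℤ.* G p ℤ.+ ⟪ cs ∣ G ⟫ℤ)            ∎
      where open ≡-Reasoning

    isInteger-⟪∣⟫ : ∀ {P : Fin m → Set} {g : Fin m → ℚ} cs → All (P ∘ proj₂) cs →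
                    (∀ p → P p → IsInteger (g p)) → IsInteger ⟪ cs ∣ g ⟫
    isInteger-⟪∣⟫ []             []         _     = isInteger-ℤ→ℚ 0ℤ
    isInteger-⟪∣⟫ ((c , p) ∷ cs) (Pp ∷ Pcs) isInt =
      isInteger-+ (isInteger-* (isInteger-ℤ→ℚ c) (isInt p Pp)) (isInteger-⟪∣⟫ cs Pcs isInt)

    ∑-*⟪∣δ⟫ : ∀ (g : Fin m → ℚ) cs → ∑ (λ k → g k * ⟪ cs ∣ δ k ⟫) ≡ ⟪ cs ∣ g ⟫
    ∑-*⟪∣δ⟫ g []             = ∑-zero (λ k → ℚP.*-zeroʳ (g k))
    ∑-*⟪∣δ⟫ g ((c , p) ∷ cs) = begin
      ∑ (λ k → g k * (ℤ→ℚ c * δ k p + ⟪ cs ∣ δ k ⟫))                    ≡⟨ ∑-cong (λ k → ℚP.*-distribˡ-+ (g k) _ _) ⟩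
      ∑ (λ k → g k * (ℤ→ℚ c * δ k p) + g k * ⟪ cs ∣ δ k ⟫)              ≡⟨ ∑-distrib-+ (λ k → g k * (ℤ→ℚ c * δ k p)) _ ⟩
      ∑ (λ k → g k * (ℤ→ℚ c * δ k p)) + ∑ (λ k → g k * ⟪ cs ∣ δ k ⟫)    ≡⟨ cong₂ _+_ (∑-cong (λ k → swap (g k) (ℤ→ℚ c) (δ k p))) (∑-*⟪∣δ⟫ g cs) ⟩
      ∑ (λ k → ℤ→ℚ c * g k * δ k p) + ⟪ cs ∣ g ⟫                        ≡⟨ cong (_+ ⟪ cs ∣ g ⟫) (∑-δʳ (λ k → ℤ→ℚ c * g k) p) ⟩
      ℤ→ℚ c * g p + ⟪ cs ∣ g ⟫                                          ∎
      where
      open ≡-Reasoning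
      swap : ∀ x c d → x * (c * d) ≡ c * x * d
      swap = solve 3 (λ x c d → x :* (c :* d) := c :* x :* d) refl

  module _ {m} (g : Fin m → ℚ) where

    ⟪chain∣⟫ : ∀ l y → ⟪ (1ℤ , l) ∷ (-1ℤ , y) ∷ [] ∣ g ⟫ ≡ g l - g y
    ⟪chain∣⟫ l y = evaluate (g l) (g y)
      where
      evaluate : ∀ a b → ℤ→ℚ 1ℤ * a + (ℤ→ℚ -1ℤ * b + 0ℚ) ≡ a - b
      evaluate = solve 2 (λ a b → con (ℤ→ℚ 1ℤ) :* a :+ (con (ℤ→ℚ -1ℤ) :* b :+ con 0ℚ) := a :- b) refl

    ⟪square∣⟫ : ∀ l y₁ y₂ d → ⟪ (1ℤ , l) ∷ (-1ℤ , y₁) ∷ (-1ℤ , y₂) ∷ (1ℤ , d) ∷ [] ∣ g ⟫ ≡ g l - g y₁ - g y₂ + g d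
    ⟪square∣⟫ l y₁ y₂ d = evaluate (g l) (g y₁) (g y₂) (g d)
      where
      evaluate : ∀ a b c e → ℤ→ℚ 1ℤ * a + (ℤ→ℚ -1ℤ * b + (ℤ→ℚ -1ℤ * c + (ℤ→ℚ 1ℤ * e + 0ℚ))) ≡ a - b - c + e
      evaluate = solve 4 (λ a b c e →
        con (ℤ→ℚ 1ℤ) :* a :+ (con (ℤ→ℚ -1ℤ) :* b :+ (con (ℤ→ℚ -1ℤ) :* c :+ (con (ℤ→ℚ 1ℤ) :* e :+ con 0ℚ)))
          := a :- b :- c :+ e) refl

    ⟪chain∣⟫-cancel : ∀ {l y} → g l ≡ g y → ⟪ (1ℤ , l) ∷ (-1ℤ , y) ∷ [] ∣ g ⟫ ≡ 0ℚ
    ⟪chain∣⟫-cancel {l} {y} gₗ≡gᵧ = trans (⟪chain∣⟫ l y) (trans (cong (_- g y) gₗ≡gᵧ) (ℚP.+-inverseʳ (g y)))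

    ⟪square∣⟫-cancel : ∀ {l y₁ y₂ d} → (g l ≡ g y₁ × g y₂ ≡ g d) ⊎ (g l ≡ g y₂ × g y₁ ≡ g d) →
                       ⟪ (1ℤ , l) ∷ (-1ℤ , y₁) ∷ (-1ℤ , y₂) ∷ (1ℤ , d) ∷ [] ∣ g ⟫ ≡ 0ℚ
    ⟪square∣⟫-cancel {l} {y₁} {y₂} {d} pairing = trans (⟪square∣⟫ l y₁ y₂ d) (cancel pairing)
      where
      cancel₁ : ∀ a c → a - a - c + c ≡ 0ℚ
      cancel₁ = solve 2 (λ a c → a :- a :- c :+ c := con 0ℚ) refl
      cancel₂ : ∀ a b → a - b - a + b ≡ 0ℚ
      cancel₂ = solve 2 (λ a b → a :- b :- a :+ b := con 0ℚ) refl
      cancel : (g l ≡ g y₁ × g y₂ ≡ g d) ⊎ (g l ≡ g y₂ × g y₁ ≡ g d) → g l - g y₁ - g y₂ + g d ≡ 0ℚ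
      cancel (inj₁ (gₗ≡gy₁ , gy₂≡gd)) = trans (cong₂ (λ a e → a - g y₁ - g y₂ + e) gₗ≡gy₁ (sym gy₂≡gd)) (cancel₁ (g y₁) (g y₂))
      cancel (inj₂ (gₗ≡gy₂ , gy₁≡gd)) = trans (cong₂ (λ a e → a - g y₁ - g y₂ + e) gₗ≡gy₂ (sym gy₁≡gd)) (cancel₂ (g y₂) (g y₁))

  module _ {m} (G : Fin m → ℤ) where

    ⟪chain∣⟫ℤ : ∀ l y → ⟪ (1ℤ , l) ∷ (-1ℤ , y) ∷ [] ∣ G ⟫ℤ ≡ G l ℤ.- G y
    ⟪chain∣⟫ℤ l y = evaluate (G l) (G y)
      where
      evaluate : ∀ a b → 1ℤ ℤ.* a ℤ.+ (-1ℤ ℤ.* b ℤ.+ 0ℤ) ≡ a ℤ.- b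
      evaluate = ℤ-solve-∀

    ⟪square∣⟫ℤ : ∀ l y₁ y₂ d → ⟪ (1ℤ , l) ∷ (-1ℤ , y₁) ∷ (-1ℤ , y₂) ∷ (1ℤ , d) ∷ [] ∣ G ⟫ℤ ≡ G l ℤ.- G y₁ ℤ.- G y₂ ℤ.+ G d
    ⟪square∣⟫ℤ l y₁ y₂ d = evaluate (G l) (G y₁) (G y₂) (G d)
      where
      evaluate : ∀ a b c e → 1ℤ ℤ.* a ℤ.+ (-1ℤ ℤ.* b ℤ.+ (-1ℤ ℤ.* c ℤ.+ (1ℤ ℤ.* e ℤ.+ 0ℤ))) ≡ a ℤ.- b ℤ.- c ℤ.+ e
      evaluate = ℤ-solve-∀

  𝟙∣ : ℕ → ℕ → ℚ
  𝟙∣ d n = if does (d ∣? n) then 1ℚ else 0ℚ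

  𝟙∣-yes : ∀ {d n} → d ∣ n → 𝟙∣ d n ≡ 1ℚ
  𝟙∣-yes {d} {n} d∣n = cong (if_then 1ℚ else 0ℚ) (dec-true (d ∣? n) d∣n)

  𝟙∣-no : ∀ {d n} → ¬ d ∣ n → 𝟙∣ d n ≡ 0ℚ
  𝟙∣-no {d} {n} d∤n = cong (if_then 1ℚ else 0ℚ) (dec-false (d ∣? n) d∤n)

  𝟙∣-gcd : ∀ d n → 𝟙∣ d (gcd d n) ≡ 𝟙∣ d n
  𝟙∣-gcd d n with d ∣? n
  ... | yes d∣n = 𝟙∣-yes (gcd-greatest ∣-refl d∣n)
  ... | no  d∤n = 𝟙∣-no (d∤n ∘ (λ d∣gcd → ∣-trans d∣gcd (gcd[m,n]∣n d n)))

  -- (1 , l) ∷ proper l encodes μ(·, l), the Möbius function of the divisor order on t, as (value , point) pairs.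
  record MöbiusColumns {m} (t : Fin m → ℕ) : Set where
    field
      proper          : Fin m → Combination m
      proper-divides  : ∀ l → All (λ cp → t (proj₂ cp) ∣ t l × t (proj₂ cp) < t l) (proper l)
      column-vanishes : ∀ l i (f : ℕ → ℚ) → ¬ t l ∣ t i →
                        ⟪ (1ℤ , l) ∷ proper l ∣ (λ p → f (gcd (t i) (t p))) ⟫ ≡ 0ℚ

open Combinations

module GcdMatrixInverse {m} (t : Fin m → ℕ) (t-inc : StrictlyIncreasing t) (t-pos : Positive t)
  (columns : MöbiusColumns t) where

  open import Data.Nat as ℕ using (ℕ; _<_)
  open import Data.Nat.Divisibility using (_∣_; _∣?_; ∣⇒≤; ∣-refl; ∣-trans; ∣-antisym)
  open import Data.Nat.GCD using (gcd; gcd-comm)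
  import Data.Nat.Properties as ℕP
  open import Data.Integer using (1ℤ)
  open import Data.Fin as F using (Fin)
  import Data.Fin.Properties as FP
  open import Data.Rational using (ℚ; 0ℚ; 1ℚ; _+_; _*_)
  import Data.Rational.Properties as ℚP
  open import Data.List using (List; _∷_)
  open import Data.List.Relation.Unary.All using (All; _∷_)
  open import Data.Product using (_,_; proj₁; proj₂)
  open import Function using (_∘_)
  open import Relation.Binary.PropositionalEquality
  open import Data.Rational.Solver using (module +-*-Solver)
  open +-*-Solver using (solve; _:*_; con; _:=_)
  open import Relation.Nullary using (yes; no)
  open import Data.Integer.Tactic.RingSolver using () renaming (solve-∀ to ℤ-solve-∀)

  open MöbiusColumns columns

  column : Fin m → Combination m
  column l = (1ℤ , l) ∷ proper l

  column-divides : ∀ l → All (λ cp → t (proj₂ cp) ∣ t l) (column l)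
  column-divides l = ∣-refl ∷ Data.List.Relation.Unary.All.map proj₁ (proper-divides l)

  private
    ∣t⇒≤ : ∀ {d} j → d ∣ t j → d ℕ.≤ t j
    ∣t⇒≤ j = ∣⇒≤ {{ℕ.>-nonZero (t-pos j)}}

  μ : Mat m
  μ k l = ⟪ column l ∣ δ k ⟫

  ζ : Mat m
  ζ i k = 𝟙∣ (t i) (t k)

  column-gcd-∣ : ∀ {l i} (f : ℕ → ℚ) → t l ∣ t i →
                 ⟪ column l ∣ (λ p → f (gcd (t i) (t p))) ⟫ ≡ ⟪ column l ∣ f ∘ t ⟫
  column-gcd-∣ {l} f tₗ∣tᵢ = ⟪∣⟫-cong (column l) (column-divides l)
    (λ p tₚ∣tₗ → cong f (gcd-of-divisor (∣-trans tₚ∣tₗ tₗ∣tᵢ)))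

  column-gcd : ∀ l i (f : ℕ → ℚ) → ⟪ column l ∣ (λ p → f (gcd (t i) (t p))) ⟫ ≡ ⟪ column l ∣ f ∘ t ⟫ * ζ l i
  column-gcd l i f with t l ∣? t i
  ... | yes tₗ∣tᵢ = trans (column-gcd-∣ f tₗ∣tᵢ) (sym (ℚP.*-identityʳ α))
    where α = ⟪ column l ∣ f ∘ t ⟫
  ... | no  tₗ∤tᵢ = trans (column-vanishes l i f tₗ∤tᵢ) (sym (ℚP.*-zeroʳ α))
    where α = ⟪ column l ∣ f ∘ t ⟫

  ζ⊗μ≡δ : ∀ i l → (ζ ⊗ μ) i l ≡ δ i l
  ζ⊗μ≡δ i l with t l ∣? t i
  ... | no tₗ∤tᵢ = begin
    (ζ ⊗ μ) i l                                  ≡⟨ ∑-*⟪∣δ⟫ (ζ i) (column l) ⟩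
    ⟪ column l ∣ ζ i ⟫                           ≡⟨ ⟪∣⟫-cong (column l) (column-divides l) (λ p _ → sym (𝟙∣-gcd (t i) (t p))) ⟩
    ⟪ column l ∣ (λ p → 𝟙∣ (t i) (gcd (t i) (t p))) ⟫ ≡⟨ column-vanishes l i (𝟙∣ (t i)) tₗ∤tᵢ ⟩
    0ℚ                                           ≡⟨ δ-≢ i l (λ { refl → tₗ∤tᵢ ∣-refl }) ⟨
    δ i l                                        ∎
    where open ≡-Reasoning
  ... | yes tₗ∣tᵢ = begin
    (ζ ⊗ μ) i l                                  ≡⟨ ∑-*⟪∣δ⟫ (ζ i) (column l) ⟩
    1ℚ * ζ i l + ⟪ proper l ∣ ζ i ⟫              ≡⟨ cong₂ _+_ (ℚP.*-identityˡ (ζ i l)) proper-vanishes ⟩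
    ζ i l + 0ℚ                                   ≡⟨ ℚP.+-identityʳ (ζ i l) ⟩
    ζ i l                                        ≡⟨ ζᵢₗ≡δᵢₗ ⟩
    δ i l                                        ∎
    where
    open ≡-Reasoning
    proper-vanishes : ⟪ proper l ∣ ζ i ⟫ ≡ 0ℚ
    proper-vanishes = ⟪∣⟫-zero (proper l) (proper-divides l)
      (λ p (_ , tₚ<tₗ) → 𝟙∣-no (λ tᵢ∣tₚ → ℕP.<⇒≱ tₚ<tₗ (ℕP.≤-trans (∣t⇒≤ i tₗ∣tᵢ) (∣t⇒≤ p tᵢ∣tₚ))))
    ζᵢₗ≡δᵢₗ : ζ i l ≡ δ i l
    ζᵢₗ≡δᵢₗ with i FP.≟ l
    ... | yes refl = trans (𝟙∣-yes (∣-refl {t i})) (sym (δ-diag i))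
    ... | no  i≢l  = trans (𝟙∣-no (λ tᵢ∣tₗ → i≢l (strictlyIncreasing⇒injective t-inc (∣-antisym tᵢ∣tₗ tₗ∣tᵢ)))) (sym (δ-≢ i l i≢l))

  μ-upperUnitriangular : UpperUnitriangular μ
  μ-upperUnitriangular = record { diagonal = diag ; below-diagonal = below-diag }
    where
    diag : ∀ l → μ l l ≡ 1ℚ
    diag l = begin
      1ℚ * δ l l + ⟪ proper l ∣ δ l ⟫  ≡⟨ cong₂ (λ x y → 1ℚ * x + y) (δ-diag l)
                                          (⟪∣⟫-zero {g = δ l} (proper l) (proper-divides l)
                                            (λ p (_ , tₚ<tₗ) → δ-≢ l p (λ { refl → ℕP.<-irrefl refl tₚ<tₗ }))) ⟩
      1ℚ                               ∎
      where open ≡-Reasoning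
    below-diag : ∀ k l → l F.< k → μ k l ≡ 0ℚ
    below-diag k l l<k = begin
      1ℚ * δ k l + ⟪ proper l ∣ δ k ⟫  ≡⟨ cong₂ (λ x y → 1ℚ * x + y) (δ-≢ k l (λ { refl → FP.<-irrefl refl l<k }))
                                          (⟪∣⟫-zero {g = δ k} (proper l) (proper-divides l)
                                            (λ p (_ , tₚ<tₗ) → δ-≢ k p (λ { refl → ℕP.<-asym tₚ<tₗ (t-inc l k l<k) }))) ⟩
      0ℚ                               ∎
      where open ≡-Reasoning

  μ⊗ζ≡δ : ∀ i j → (μ ⊗ ζ) i j ≡ δ i j
  μ⊗ζ≡δ = leftInverse⇒rightInverse μ-upperUnitriangular ζ⊗μ≡δ

  isInteger-μ : ∀ k l → IsInteger (μ k l)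
  isInteger-μ k l = isInteger-⟪∣⟫ (column l) (column-divides l) (λ p _ → isInteger-δ k p)

  module Weighted (w : Fin m → ℚ) (w≢0 : ∀ i → w i ≢ 0ℚ) (f : ℕ → ℚ)
                  (α≢0 : ∀ l → ⟪ column l ∣ f ∘ t ⟫ ≢ 0ℚ) where

    α : Fin m → ℚ
    α l = ⟪ column l ∣ f ∘ t ⟫

    -- B = W ζᵀ diag(α) ζ W with W = diag(w), hence B⁻¹ = W⁻¹ μ diag(α)⁻¹ μᵀ W⁻¹.
    X : Mat m
    X k j = ∑ λ l → μ k l * μ j l * (w k ⁻¹ * w j ⁻¹ * α l ⁻¹)

    ⊗X : ∀ (A : Mat m) i j → (A ⊗ X) i j ≡ ∑ (λ l → ⟪ column l ∣ (λ p → A i p * w p ⁻¹) ⟫ * (μ j l * w j ⁻¹ * α l ⁻¹))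
    ⊗X A i j = begin
      ∑ (λ k → A i k * ∑ (λ l → μ k l * μ j l * c k l))    ≡⟨ ∑-cong (λ k → *-distribˡ-∑ (A i k) (λ l → μ k l * μ j l * c k l)) ⟩
      ∑ (λ k → ∑ (λ l → A i k * (μ k l * μ j l * c k l)))  ≡⟨ ∑-comm (λ k l → A i k * (μ k l * μ j l * c k l)) ⟩
      ∑ (λ l → ∑ (λ k → A i k * (μ k l * μ j l * c k l)))  ≡⟨ ∑-cong (λ l → ∑-cong (λ k → regroup (A i k) (μ k l) (μ j l) (w k ⁻¹) (w j ⁻¹) (α l ⁻¹))) ⟩
      ∑ (λ l → ∑ (λ k → A i k * w k ⁻¹ * μ k l * d l))     ≡⟨ ∑-cong (λ l → *-distribʳ-∑ (d l) (λ k → A i k * w k ⁻¹ * μ k l)) ⟨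
      ∑ (λ l → ∑ (λ k → A i k * w k ⁻¹ * μ k l) * d l)     ≡⟨ ∑-cong (λ l → cong (_* d l) (∑-*⟪∣δ⟫ (λ k → A i k * w k ⁻¹) (column l))) ⟩
      ∑ (λ l → ⟪ column l ∣ (λ p → A i p * w p ⁻¹) ⟫ * d l) ∎
      where
      open ≡-Reasoning
      c : Fin m → Fin m → ℚ
      c k l = w k ⁻¹ * w j ⁻¹ * α l ⁻¹
      d : Fin m → ℚ
      d l = μ j l * w j ⁻¹ * α l ⁻¹
      regroup : ∀ a x y u v z → a * (x * y * (u * v * z)) ≡ a * u * x * (y * v * z)
      regroup = solve 6 (λ a x y u v z → a :* (x :* y :* (u :* v :* z)) := a :* u :* x :* (y :* v :* z)) refl

    module _ {B : Mat m} (B≡ : ∀ i k → B i k ≡ w i * w k * f (gcd (t i) (t k))) where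

      private
        column-B : ∀ i l → ⟪ column l ∣ (λ p → B i p * w p ⁻¹) ⟫ ≡ w i * (α l * ζ l i)
        column-B i l = begin
          ⟪ column l ∣ (λ p → B i p * w p ⁻¹) ⟫                ≡⟨ ⟪∣⟫-cong (column l) (column-divides l) (λ p _ → cancel p) ⟩
          ⟪ column l ∣ (λ p → w i * f (gcd (t i) (t p))) ⟫     ≡⟨ ⟪∣⟫-*ˡ (w i) (λ p → f (gcd (t i) (t p))) (column l) ⟩
          w i * ⟪ column l ∣ (λ p → f (gcd (t i) (t p))) ⟫     ≡⟨ cong (w i *_) (column-gcd l i f) ⟩
          w i * (α l * ζ l i)                                  ∎
          where
          open ≡-Reasoning
          regroup : ∀ a b c d → a * b * c * d ≡ a * c * (b * d)
          regroup = solve 4 (λ a b c d → a :* b :* c :* d := a :* c :* (b :* d)) refl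
          cancel : ∀ p → B i p * w p ⁻¹ ≡ w i * f (gcd (t i) (t p))
          cancel p = begin
            B i p * w p ⁻¹                                 ≡⟨ cong (_* w p ⁻¹) (B≡ i p) ⟩
            w i * w p * f (gcd (t i) (t p)) * w p ⁻¹       ≡⟨ regroup (w i) (w p) (f (gcd (t i) (t p))) (w p ⁻¹) ⟩
            w i * f (gcd (t i) (t p)) * (w p * w p ⁻¹)     ≡⟨ cong (w i * f (gcd (t i) (t p)) *_) (⁻¹-inverseʳ (w≢0 p)) ⟩
            w i * f (gcd (t i) (t p)) * 1ℚ                 ≡⟨ ℚP.*-identityʳ _ ⟩
            w i * f (gcd (t i) (t p))                      ∎

        B⊗X≡δ : ∀ i j → (B ⊗ X) i j ≡ δ i j
        B⊗X≡δ i j = begin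
          (B ⊗ X) i j                                                           ≡⟨ ⊗X B i j ⟩
          ∑ (λ l → ⟪ column l ∣ (λ p → B i p * w p ⁻¹) ⟫ * (μ j l * w j ⁻¹ * α l ⁻¹))
                                                                                ≡⟨ ∑-cong (λ l → cong (_* (μ j l * w j ⁻¹ * α l ⁻¹)) (column-B i l)) ⟩
          ∑ (λ l → w i * (α l * ζ l i) * (μ j l * w j ⁻¹ * α l ⁻¹))             ≡⟨ ∑-cong (λ l → cancel-α l) ⟩
          ∑ (λ l → w i * w j ⁻¹ * (μ j l * ζ l i))                              ≡⟨ *-distribˡ-∑ (w i * w j ⁻¹) (λ l → μ j l * ζ l i) ⟨
          w i * w j ⁻¹ * (μ ⊗ ζ) j i                                            ≡⟨ cong (w i * w j ⁻¹ *_) (μ⊗ζ≡δ j i) ⟩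
          w i * w j ⁻¹ * δ j i                                                  ≡⟨ scaled-δ ⟩
          δ i j                                                                 ∎
          where
          open ≡-Reasoning
          regroup : ∀ a b z x y c → a * (b * z) * (x * y * c) ≡ a * y * (x * z) * (b * c)
          regroup = solve 6 (λ a b z x y c → a :* (b :* z) :* (x :* y :* c) := a :* y :* (x :* z) :* (b :* c)) refl
          cancel-α : ∀ l → w i * (α l * ζ l i) * (μ j l * w j ⁻¹ * α l ⁻¹) ≡ w i * w j ⁻¹ * (μ j l * ζ l i)
          cancel-α l = begin
            w i * (α l * ζ l i) * (μ j l * w j ⁻¹ * α l ⁻¹)         ≡⟨ regroup (w i) (α l) (ζ l i) (μ j l) (w j ⁻¹) (α l ⁻¹) ⟩
            w i * w j ⁻¹ * (μ j l * ζ l i) * (α l * α l ⁻¹)         ≡⟨ cong (w i * w j ⁻¹ * (μ j l * ζ l i) *_) (⁻¹-inverseʳ (α≢0 l)) ⟩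
            w i * w j ⁻¹ * (μ j l * ζ l i) * 1ℚ                     ≡⟨ ℚP.*-identityʳ _ ⟩
            w i * w j ⁻¹ * (μ j l * ζ l i)                          ∎
          scaled-δ : w i * w j ⁻¹ * δ j i ≡ δ i j
          scaled-δ with i FP.≟ j
          ... | yes refl = trans (cong₂ _*_ (⁻¹-inverseʳ (w≢0 i)) (δ-diag i)) (sym (δ-diag i))
          ... | no  i≢j  = trans (cong (w i * w j ⁻¹ *_) (δ-≢ j i (i≢j ∘ sym)))
                                 (trans (ℚP.*-zeroʳ (w i * w j ⁻¹)) (sym (δ-≢ i j i≢j)))

        B-sym : ∀ i k → B i k ≡ B k i
        B-sym i k = trans (B≡ i k) (trans (cong₂ (λ x y → x * f y) (ℚP.*-comm (w i) (w k)) (gcd-comm (t i) (t k))) (sym (B≡ k i)))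

        X-sym : ∀ k j → X k j ≡ X j k
        X-sym k j = ∑-cong (λ l → cong₂ _*_ (ℚP.*-comm (μ k l) (μ j l)) (cong (_* α l ⁻¹) (ℚP.*-comm (w k ⁻¹) (w j ⁻¹))))

      isInverse : IsInverse B X
      isInverse = B⊗X≡δ , X⊗B≡δ
        where
        X⊗B≡δ : ∀ i j → (X ⊗ B) i j ≡ δ i j
        X⊗B≡δ i j = trans (∑-cong (λ k → trans (cong₂ _*_ (X-sym i k) (B-sym k j)) (ℚP.*-comm (X k i) (B j k))))
                          (trans (B⊗X≡δ j i) (δ-sym j i))

    isIntegral-⊗X : ∀ (A : Mat m) →
      (∀ i l → IsInteger (⟪ column l ∣ (λ p → A i p * w p ⁻¹) ⟫ * (α l * w l) ⁻¹)) →
      (∀ j l → IsInteger (μ j l * w l * w j ⁻¹)) →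
      IsIntegral (A ⊗ X)
    isIntegral-⊗X A column-int μ-int i j =
      subst IsInteger (sym (⊗X A i j)) (isInteger-∑ λ l → subst IsInteger (split l) (isInteger-* (column-int i l) (μ-int j l)))
      where
      Q : Fin m → ℚ
      Q l = ⟪ column l ∣ (λ p → A i p * w p ⁻¹) ⟫
      split : ∀ l → Q l * (α l * w l) ⁻¹ * (μ j l * w l * w j ⁻¹) ≡ Q l * (μ j l * w j ⁻¹ * α l ⁻¹)
      split l = begin
        Q l * (α l * w l) ⁻¹ * (μ j l * w l * w j ⁻¹)       ≡⟨ cong (λ z → Q l * z * (μ j l * w l * w j ⁻¹)) (⁻¹-distrib-* (α≢0 l) (w≢0 l)) ⟩
        Q l * (α l ⁻¹ * w l ⁻¹) * (μ j l * w l * w j ⁻¹)     ≡⟨ regroup (Q l) (α l ⁻¹) (w l ⁻¹) (μ j l) (w l) (w j ⁻¹) ⟩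
        Q l * (μ j l * w j ⁻¹ * α l ⁻¹) * (w l * w l ⁻¹)     ≡⟨ cong (Q l * (μ j l * w j ⁻¹ * α l ⁻¹) *_) (⁻¹-inverseʳ (w≢0 l)) ⟩
        Q l * (μ j l * w j ⁻¹ * α l ⁻¹) * 1ℚ                 ≡⟨ ℚP.*-identityʳ _ ⟩
        Q l * (μ j l * w j ⁻¹ * α l ⁻¹)                      ∎
        where
        open ≡-Reasoning
        regroup : ∀ q a v x u y → q * (a * v) * (x * u * y) ≡ q * (x * y * a) * (u * v)
        regroup = solve 6 (λ q a v x u y → q :* (a :* v) :* (x :* u :* y) := q :* (x :* y :* a) :* (u :* v)) refl

  module Unweighted (f : ℕ → ℚ) (α≢0 : ∀ l → ⟪ column l ∣ f ∘ t ⟫ ≢ 0ℚ) where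

    open Weighted (λ _ → 1ℚ) (λ _ → ℚP.1≢0) f α≢0 public
      hiding (isIntegral-⊗X)

    isIntegral-⊗X : ∀ (A : Mat m) → (∀ i l → IsInteger (⟪ column l ∣ A i ⟫ * α l ⁻¹)) → IsIntegral (A ⊗ X)
    isIntegral-⊗X A column-int = Weighted.isIntegral-⊗X (λ _ → 1ℚ) (λ _ → ℚP.1≢0) f α≢0 A
      (λ i l → subst IsInteger (cong₂ (λ x y → x * y ⁻¹) (⟪∣⟫-cong (column l) (column-divides l) (λ p _ → sym (ℚP.*-identityʳ (A i p))))
                                                        (sym (ℚP.*-identityʳ (α l))))
                     (column-int i l))
      (λ j l → subst IsInteger (sym (trans (ℚP.*-identityʳ (μ j l * 1ℚ)) (ℚP.*-identityʳ (μ j l)))) (isInteger-μ j l))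

module ConditionG {m} (t : Fin m → ℕ) (t-inc : StrictlyIncreasing t) (t-pos : Positive t)
  (gcd-closed : GcdClosed t) (condG : SetCondG t) (atMostTwo : ∀ j → GAtMostTwo t j) where

  open import Data.Nat as ℕ using (ℕ; _*_; _<_; _≤_; NonZero)
  import Data.Nat.Properties as ℕP
  open import Data.Nat.Divisibility using (_∣_; _∣?_; quotient; quotient>1; ∣-refl; ∣-trans; ∣-antisym; ∣⇒≤)
  open Data.Nat.Divisibility._∣_ using (equality)
  open import Data.Nat.GCD using (gcd; gcd[m,n]∣m; gcd[m,n]∣n; gcd[m,n]≢0; gcd-comm)
  open import Data.Nat.LCM using (lcm; m∣lcm[m,n]; n∣lcm[m,n]; lcm-least; lcm-comm; gcd*lcm)
  open import Data.Nat.Induction using (<-wellFounded)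
  open import Data.Nat.Tactic.RingSolver using () renaming (solve-∀ to ℕ-solve-∀)
  open import Data.Integer using (1ℤ; -1ℤ)
  open import Data.Fin using (Fin)
  import Data.Fin.Properties as FP
  open import Data.List using (List; []; _∷_; filter; allFin)
  open import Data.List.Relation.Unary.All using (All; []; _∷_; lookup)
  open import Data.List.Relation.Unary.All.Properties using (all-filter)
  open import Data.List.Membership.Propositional.Properties using (∈-filter⁺; ∈-allFin)
  open import Data.List.Extrema ℕP.≤-totalOrder using (argmax; argmax-all; f[xs]≤f[argmax])
  open import Data.Product using (∃; _×_; _,_; proj₁; proj₂)
  open import Data.Rational using (ℚ; 0ℚ)
  open import Data.Sum using (_⊎_; inj₁; inj₂)
  open import Induction.WellFounded using (Acc; acc)
  open import Relation.Binary.PropositionalEquality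
  open import Relation.Nullary using (¬_; Dec; yes; no; contradiction)
  open import Relation.Nullary.Decidable using (_×-dec_; _⊎-dec_; _→-dec_)

  gtd-< : ∀ {k l} → IsGTD t k l → t k < t l
  gtd-< = proj₁

  gtd-∣ : ∀ {k l} → IsGTD t k l → t k ∣ t l
  gtd-∣ g = proj₁ (proj₂ g)

  private
    ∣t⇒≤ : ∀ {d} j → d ∣ t j → d ≤ t j
    ∣t⇒≤ j = ∣⇒≤ {{ℕ.>-nonZero (t-pos j)}}

    ∣t∧≢⇒< : ∀ {d} j → d ∣ t j → d ≢ t j → d < t j
    ∣t∧≢⇒< j d∣tⱼ d≢tⱼ = ℕP.≤∧≢⇒< (∣t⇒≤ j d∣tⱼ) d≢tⱼ

  gtd-above : ∀ {k l} → t k ∣ t l → t k < t l → ∃ λ y → IsGTD t y l × t k ∣ t y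
  gtd-above {k} {l} tₖ∣tₗ tₖ<tₗ = c , (c<l , c∣l , maximal) , k∣c
    where
    Between : Fin m → Set
    Between z = t k ∣ t z × t z ∣ t l × t z < t l
    between? : ∀ z → Dec (Between z)
    between? z = t k ∣? t z ×-dec t z ∣? t l ×-dec t z ℕ.<? t l
    candidates : List (Fin m)
    candidates = filter between? (allFin m)
    c : Fin m
    c = argmax t k candidates
    c-between : Between c
    c-between = argmax-all t {P = Between} (∣-refl , tₖ∣tₗ , tₖ<tₗ) (all-filter between? (allFin m))
    k∣c = proj₁ c-between
    c∣l = proj₁ (proj₂ c-between)
    c<l = proj₂ (proj₂ c-between)
    largest : ∀ z → Between z → t z ≤ t c
    largest z z-between = lookup (f[xs]≤f[argmax] k candidates) (∈-filter⁺ between? (∈-allFin z) z-between)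
    maximal : ∀ z → t c ∣ t z → t z ∣ t l → t z ≡ t c ⊎ t z ≡ t l
    maximal z c∣z z∣l with t z ℕP.≟ t l
    ... | yes z≡l = inj₂ z≡l
    ... | no  z≢l = inj₁ (ℕP.≤-antisym (largest z (∣-trans k∣c c∣z , z∣l , ∣t∧≢⇒< l z∣l z≢l)) (∣t⇒≤ z c∣z))

  -- Induction along greatest-type divisors: g lies below some s ∈ G(x) other than p, condition 𝒢 gives
  -- lcm(p, s) = x with r = gcd(p, s) ∈ G(s), and lcm(g, r) = s by induction.
  lcm-gtd : ∀ {p x g} → IsGTD t p x → t g ∣ t x → ¬ t g ∣ t p → lcm (t g) (t p) ≡ t x
  lcm-gtd = go (<-wellFounded _)
    where
    go : ∀ {p x g} → Acc _<_ (t x) → IsGTD t p x → t g ∣ t x → ¬ t g ∣ t p → lcm (t g) (t p) ≡ t x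
    go {p} {x} {g} (acc rec) p-gtd g∣x g∤p with t g ℕP.≟ t x
    ... | yes g≡x = trans (cong (λ z → lcm z (t p)) g≡x) (lcm-of-divisor (gtd-∣ p-gtd))
    ... | no  g≢x with gtd-above g∣x (∣t∧≢⇒< x g∣x g≢x)
    ...   | s , s-gtd , g∣s with condG x
    ...     | inj₁ unique = contradiction (subst (λ z → t g ∣ t z) (unique s p s-gtd p-gtd) g∣s) g∤p
    ...     | inj₂ (_ , condGₓ) with condGₓ p s (λ { refl → g∤p g∣s }) p-gtd s-gtd
    ...       | lcm[p,s]≡x , r , _ , r-gtd-p , r-gtd-s =
      ∣-antisym (lcm-least g∣x (gtd-∣ p-gtd)) (subst (_∣ lcm (t g) (t p)) lcm[p,s]≡x (lcm-least (n∣lcm[m,n] (t g) (t p)) s∣lcm))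
      where
      lcm[g,r]≡s : lcm (t g) (t r) ≡ t s
      lcm[g,r]≡s = go (rec (gtd-< s-gtd)) r-gtd-s g∣s (λ g∣r → g∤p (∣-trans g∣r (gtd-∣ r-gtd-p)))
      s∣lcm : t s ∣ lcm (t g) (t p)
      s∣lcm = subst (_∣ lcm (t g) (t p)) lcm[g,r]≡s
        (lcm-least (m∣lcm[m,n] (t g) (t p)) (∣-trans (gtd-∣ r-gtd-p) (n∣lcm[m,n] (t g) (t p))))

  record Square (l : Fin m) : Set where
    field
      y₁ y₂ d   : Fin m
      y₁-gtd    : IsGTD t y₁ l
      y₂-gtd    : IsGTD t y₂ l
      gtd-cases : ∀ k → IsGTD t k l → k ≡ y₁ ⊎ k ≡ y₂
      lcm≡      : lcm (t y₁) (t y₂) ≡ t l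
      d≡gcd     : t d ≡ gcd (t y₁) (t y₂)
      d-gtd₁    : IsGTD t d y₁
      d-gtd₂    : IsGTD t d y₂
      u v       : ℕ
      y₁≡       : t y₁ ≡ u * t d
      y₂≡       : t y₂ ≡ v * t d
      l≡        : t l ≡ u * v * t d
      1<u       : 1 < u
      1<v       : 1 < v

  module _ {l : Fin m} (sq : Square l) where

    open Square sq

    l≡v*y₁ : t l ≡ v * t y₁
    l≡v*y₁ = trans l≡ (trans (regroup u v (t d)) (cong (v *_) (sym y₁≡)))
      where
      regroup : ∀ u v d → u * v * d ≡ v * (u * d)
      regroup = ℕ-solve-∀

    l≡u*y₂ : t l ≡ u * t y₂
    l≡u*y₂ = trans l≡ (trans (ℕP.*-assoc u v (t d)) (cong (u *_) (sym y₂≡)))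

  data Shape (l : Fin m) : Set where
    minimal : (∀ k → ¬ IsGTD t k l) → Shape l
    chain   : ∀ {y} → IsGTD t y l → (∀ k → IsGTD t k l → k ≡ y) → Shape l
    square  : Square l → Shape l

  private
    isGTD? : ∀ k l → Dec (IsGTD t k l)
    isGTD? k l = t k ℕ.<? t l ×-dec t k ∣? t l ×-dec
      FP.all? (λ z → t k ∣? t z →-dec t z ∣? t l →-dec (t z ℕP.≟ t k ⊎-dec t z ℕP.≟ t l))

    mkSquare : ∀ {l y₁ y₂ d} → IsGTD t y₁ l → IsGTD t y₂ l → (∀ k → IsGTD t k l → k ≡ y₁ ⊎ k ≡ y₂) →
               lcm (t y₁) (t y₂) ≡ t l → t d ≡ gcd (t y₁) (t y₂) → IsGTD t d y₁ → IsGTD t d y₂ → Square l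
    mkSquare {l} {y₁} {y₂} {d} y₁-gtd y₂-gtd gtd-cases lcm≡ d≡gcd d-gtd₁ d-gtd₂ = record
      { y₁ = y₁ ; y₂ = y₂ ; d = d ; y₁-gtd = y₁-gtd ; y₂-gtd = y₂-gtd ; gtd-cases = gtd-cases
      ; lcm≡ = lcm≡ ; d≡gcd = d≡gcd ; d-gtd₁ = d-gtd₁ ; d-gtd₂ = d-gtd₂
      ; u = u ; v = v ; y₁≡ = y₁≡ ; y₂≡ = y₂≡ ; l≡ = l≡
      ; 1<u = quotient>1 (gtd-∣ d-gtd₁) (gtd-< d-gtd₁) ; 1<v = quotient>1 (gtd-∣ d-gtd₂) (gtd-< d-gtd₂) }
      where
      open ≡-Reasoning
      u = quotient (gtd-∣ d-gtd₁)
      v = quotient (gtd-∣ d-gtd₂)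
      y₁≡ = equality (gtd-∣ d-gtd₁)
      y₂≡ = equality (gtd-∣ d-gtd₂)
      instance
        tᵈ≢0 : NonZero (t d)
        tᵈ≢0 = ℕ.>-nonZero (t-pos d)
      regroup : ∀ u v D → u * D * (v * D) ≡ D * (u * v * D)
      regroup = ℕ-solve-∀
      l≡ : t l ≡ u * v * t d
      l≡ = ℕP.*-cancelˡ-≡ (t l) (u * v * t d) (t d) (begin
        t d * t l                              ≡⟨ cong₂ _*_ d≡gcd (sym lcm≡) ⟩
        gcd (t y₁) (t y₂) * lcm (t y₁) (t y₂)  ≡⟨ gcd*lcm (t y₁) (t y₂) ⟩
        t y₁ * t y₂                            ≡⟨ cong₂ _*_ y₁≡ y₂≡ ⟩
        u * t d * (v * t d)                    ≡⟨ regroup u v (t d) ⟩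
        t d * (u * v * t d)                    ∎)

  shape : ∀ l → Shape l
  shape l with condG l
  ... | inj₁ unique with FP.any? (λ k → isGTD? k l)
  ...   | yes (y , y-gtd) = chain y-gtd (λ k k-gtd → unique k y k-gtd y-gtd)
  ...   | no  none        = minimal (λ k k-gtd → none (k , k-gtd))
  shape l | inj₂ ((y₁ , y₂ , y₁≢y₂ , y₁-gtd , y₂-gtd) , condGₗ) with condGₗ y₁ y₂ y₁≢y₂ y₁-gtd y₂-gtd
  ... | lcm≡ , d , d≡gcd , d-gtd₁ , d-gtd₂ = square (mkSquare y₁-gtd y₂-gtd gtd-cases lcm≡ d≡gcd d-gtd₁ d-gtd₂)
    where
    gtd-cases : ∀ k → IsGTD t k l → k ≡ y₁ ⊎ k ≡ y₂
    gtd-cases k k-gtd with atMostTwo l y₁ y₂ k y₁-gtd y₂-gtd k-gtd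
    ... | inj₁ y₁≡y₂        = contradiction y₁≡y₂ y₁≢y₂
    ... | inj₂ (inj₁ y₁≡k) = inj₁ (sym y₁≡k)
    ... | inj₂ (inj₂ y₂≡k) = inj₂ (sym y₂≡k)

  properOf : ∀ {l} → Shape l → Combination m
  properOf (minimal _)   = []
  properOf (chain {y} _ _) = (-1ℤ , y) ∷ []
  properOf (square sq)   = (-1ℤ , y₁) ∷ (-1ℤ , y₂) ∷ (1ℤ , d) ∷ []
    where open Square sq

  columnOf : ∀ {l} → Shape l → Combination m
  columnOf {l} s = (1ℤ , l) ∷ properOf s

  proper : Fin m → Combination m
  proper l = properOf (shape l)

  proper-divides : ∀ l → All (λ cp → t (proj₂ cp) ∣ t l × t (proj₂ cp) < t l) (proper l)
  proper-divides l = divides-below (shape l)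
    where
    divides-below : (s : Shape l) → All (λ cp → t (proj₂ cp) ∣ t l × t (proj₂ cp) < t l) (properOf s)
    divides-below (minimal _)         = []
    divides-below (chain y-gtd _)     = (gtd-∣ y-gtd , gtd-< y-gtd) ∷ []
    divides-below (square sq)         =
      (gtd-∣ y₁-gtd , gtd-< y₁-gtd) ∷ (gtd-∣ y₂-gtd , gtd-< y₂-gtd) ∷
      (∣-trans (gtd-∣ d-gtd₁) (gtd-∣ y₁-gtd) , ℕP.<-trans (gtd-< d-gtd₁) (gtd-< y₁-gtd)) ∷ []
      where open Square sq


  record GcdBelow (i l : Fin m) : Set where
    field
      g y   : Fin m
      g≡gcd : t g ≡ gcd (t i) (t l)
      y-gtd : IsGTD t y l
      g∣y   : t g ∣ t y

    gcd∣y : gcd (t i) (t l) ∣ t y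
    gcd∣y = subst (_∣ t y) g≡gcd g∣y

  gcd-below : ∀ {i l} → ¬ t l ∣ t i → GcdBelow i l
  gcd-below {i} {l} tₗ∤tᵢ = record
    { g = g ; y = proj₁ above ; g≡gcd = g≡gcd ; y-gtd = proj₁ (proj₂ above) ; g∣y = proj₂ (proj₂ above) }
    where
    g = proj₁ (gcd-closed i l)
    g≡gcd = proj₂ (gcd-closed i l)
    g∣l : t g ∣ t l
    g∣l = subst (_∣ t l) (sym g≡gcd) (gcd[m,n]∣n (t i) (t l))
    g≢l : t g ≢ t l
    g≢l g≡l = tₗ∤tᵢ (subst (_∣ t i) (trans (sym g≡gcd) g≡l) (gcd[m,n]∣m (t i) (t l)))
    above = gtd-above g∣l (∣t∧≢⇒< l g∣l g≢l)

  column-vanishes : ∀ l i (f : ℕ → ℚ) → ¬ t l ∣ t i → ⟪ (1ℤ , l) ∷ proper l ∣ (λ p → f (gcd (t i) (t p))) ⟫ ≡ 0ℚ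
  column-vanishes l i f tₗ∤tᵢ = vanishes (shape l)
    where
    open GcdBelow (gcd-below tₗ∤tᵢ)
    F : Fin m → ℚ
    F p = f (gcd (t i) (t p))
    vanishes : (s : Shape l) → ⟪ columnOf s ∣ F ⟫ ≡ 0ℚ
    vanishes (minimal none)                  = contradiction y-gtd (none y)
    vanishes (chain {y′} y′-gtd unique) with unique y y-gtd
    ... | refl = ⟪chain∣⟫-cancel F (cong f (gcd-sandwich (t i) (gtd-∣ y-gtd) gcd∣y))
    vanishes (square sq) = ⟪square∣⟫-cancel F (pairing (gtd-cases y y-gtd))
      where
      open Square sq
      pairing : y ≡ y₁ ⊎ y ≡ y₂ → (F l ≡ F y₁ × F y₂ ≡ F d) ⊎ (F l ≡ F y₂ × F y₁ ≡ F d)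
      pairing (inj₁ refl) = inj₁ (cong f (gcd-sandwich (t i) (gtd-∣ y₁-gtd) gcd∣y) ,
        cong f (trans (gcd-sandwich₂ (t i) (gtd-∣ y₂-gtd) gcd∣y) (cong (gcd (t i)) (sym d≡gcd))))
      pairing (inj₂ refl) = inj₂ (cong f (gcd-sandwich (t i) (gtd-∣ y₂-gtd) gcd∣y) ,
        cong f (trans (gcd-sandwich₂ (t i) (gtd-∣ y₁-gtd) gcd∣y) (cong (gcd (t i)) (trans (gcd-comm (t y₂) (t y₁)) (sym d≡gcd)))))

  möbiusColumns : MöbiusColumns t
  möbiusColumns = record { proper = proper ; proper-divides = proper-divides ; column-vanishes = column-vanishes }

  record SquareLcm (i : Fin m) {l} (sq : Square l) : Set where
    open Square sq
    field
      c σ τ   : ℕ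
      σ-cases : σ ≡ 1 ⊎ σ ≡ v
      τ-cases : τ ≡ 1 ⊎ τ ≡ u
      lcm-l   : lcm (t i) (t l) ≡ c * t l
      lcm-y₁  : lcm (t i) (t y₁) ≡ c * σ * t y₁
      lcm-y₂  : lcm (t i) (t y₂) ≡ c * τ * t y₂
      lcm-d   : lcm (t i) (t d) ≡ c * σ * τ * t d

  module _ {i l} (tₗ∤tᵢ : ¬ t l ∣ t i) where

    private
      open GcdBelow (gcd-below tₗ∤tᵢ)

      instance
        gcd≢0 : NonZero (gcd (t i) (t l))
        gcd≢0 = ℕ.≢-nonZero (gcd[m,n]≢0 (t i) (t l) (inj₁ (ℕP.n>0⇒n≢0 (t-pos i))))

      c : ℕ
      c = quotient (gcd[m,n]∣m (t i) (t l))

      g∣i : t g ∣ t i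
      g∣i = subst (_∣ t i) (sym g≡gcd) (gcd[m,n]∣m (t i) (t l))

      g∣l : t g ∣ t l
      g∣l = subst (_∣ t l) (sym g≡gcd) (gcd[m,n]∣n (t i) (t l))

      lcm-below : ∀ {p} → t p ∣ t l → t g ∣ t p → lcm (t i) (t p) ≡ c * t p
      lcm-below {p} p∣l g∣p = lcm-cofactor c (sym (gcd-sandwich (t i) p∣l (subst (_∣ t p) g≡gcd g∣p)))
                                              (equality (gcd[m,n]∣m (t i) (t l)))

      c*1 : ∀ n → c * n ≡ c * 1 * n
      c*1 n = cong (_* n) (sym (ℕP.*-identityʳ c))

      lcm-half : ∀ {p q d r} → IsGTD t d p → t p ∣ t l → t d ∣ t q → lcm (t p) (t q) ≡ t l →
                 t p ≡ r * t d → t l ≡ r * t q → t g ∣ t p → ¬ t g ∣ t d →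
                 lcm (t i) (t q) ≡ c * r * t q × lcm (t i) (t d) ≡ c * r * t d
      lcm-half {p} {q} {d} {r} d-gtd p∣l d∣q lcm[p,q]≡l p≡ l≡ g∣p g∤d =
        (begin
          lcm (t i) (t q)                ≡⟨ lcm-absorb (t q) g∣i ⟨
          lcm (t i) (lcm (t g) (t q))    ≡⟨ cong (lcm (t i)) lcm[g,q]≡l ⟩
          lcm (t i) (t l)                ≡⟨ lcm-below ∣-refl g∣l ⟩
          c * t l                        ≡⟨ cong (c *_) l≡ ⟩
          c * (r * t q)                  ≡⟨ ℕP.*-assoc c r (t q) ⟨
          c * r * t q                    ∎) ,
        (begin
          lcm (t i) (t d)                ≡⟨ lcm-absorb (t d) g∣i ⟨
          lcm (t i) (lcm (t g) (t d))    ≡⟨ cong (lcm (t i)) lcm[g,d]≡p ⟩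
          lcm (t i) (t p)                ≡⟨ lcm-below p∣l g∣p ⟩
          c * t p                        ≡⟨ cong (c *_) p≡ ⟩
          c * (r * t d)                  ≡⟨ ℕP.*-assoc c r (t d) ⟨
          c * r * t d                    ∎)
        where
        open ≡-Reasoning
        lcm[g,d]≡p : lcm (t g) (t d) ≡ t p
        lcm[g,d]≡p = lcm-gtd d-gtd g∣p g∤d
        p∣lcm[g,q] : t p ∣ lcm (t g) (t q)
        p∣lcm[g,q] = subst (_∣ lcm (t g) (t q)) lcm[g,d]≡p
          (lcm-least (m∣lcm[m,n] (t g) (t q)) (∣-trans d∣q (n∣lcm[m,n] (t g) (t q))))
        lcm[g,q]≡l : lcm (t g) (t q) ≡ t l
        lcm[g,q]≡l = ∣-antisym (lcm-least g∣l (subst (t q ∣_) lcm[p,q]≡l (n∣lcm[m,n] (t p) (t q))))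
          (subst (_∣ lcm (t g) (t q)) lcm[p,q]≡l (lcm-least p∣lcm[g,q] (n∣lcm[m,n] (t g) (t q))))

    chain-lcm : ∀ {y} → IsGTD t y l → (∀ k → IsGTD t k l → k ≡ y) →
                ∃ λ c → lcm (t i) (t l) ≡ c * t l × lcm (t i) (t y) ≡ c * t y
    chain-lcm y′-gtd unique with unique y y-gtd
    ... | refl = c , lcm-below ∣-refl g∣l , lcm-below (gtd-∣ y-gtd) g∣y

    square-lcm : (sq : Square l) → SquareLcm i sq
    square-lcm sq with gtd-cases y y-gtd | t g ∣? t d
      where open Square sq
    ... | _ | yes g∣d = record
      { c = c ; σ = 1 ; τ = 1 ; σ-cases = inj₁ refl ; τ-cases = inj₁ refl
      ; lcm-l  = lcm-below ∣-refl g∣l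
      ; lcm-y₁ = trans (lcm-below (gtd-∣ y₁-gtd) (∣-trans g∣d (gtd-∣ d-gtd₁))) (c*1 (t y₁))
      ; lcm-y₂ = trans (lcm-below (gtd-∣ y₂-gtd) (∣-trans g∣d (gtd-∣ d-gtd₂))) (c*1 (t y₂))
      ; lcm-d  = trans (lcm-below (∣-trans (gtd-∣ d-gtd₁) (gtd-∣ y₁-gtd)) g∣d)
                       (trans (c*1 (t d)) (cong (_* t d) (sym (ℕP.*-identityʳ (c * 1))))) }
      where open Square sq
    ... | inj₁ refl | no g∤d = record
      { c = c ; σ = 1 ; τ = u ; σ-cases = inj₁ refl ; τ-cases = inj₂ refl
      ; lcm-l  = lcm-below ∣-refl g∣l
      ; lcm-y₁ = trans (lcm-below (gtd-∣ y₁-gtd) g∣y) (c*1 (t y₁))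
      ; lcm-y₂ = proj₁ half
      ; lcm-d  = trans (proj₂ half) (cong (λ k → k * u * t d) (sym (ℕP.*-identityʳ c))) }
      where
      open Square sq
      half = lcm-half d-gtd₁ (gtd-∣ y₁-gtd) (gtd-∣ d-gtd₂) lcm≡ y₁≡ (l≡u*y₂ sq) g∣y g∤d
    ... | inj₂ refl | no g∤d = record
      { c = c ; σ = v ; τ = 1 ; σ-cases = inj₂ refl ; τ-cases = inj₁ refl
      ; lcm-l  = lcm-below ∣-refl g∣l
      ; lcm-y₁ = proj₁ half
      ; lcm-y₂ = trans (lcm-below (gtd-∣ y₂-gtd) g∣y) (c*1 (t y₂))
      ; lcm-d  = trans (proj₂ half) (cong (_* t d) (sym (ℕP.*-identityʳ (c * v)))) }
      where
      open Square sq
      half = lcm-half d-gtd₂ (gtd-∣ y₂-gtd) (gtd-∣ d-gtd₁) (trans (lcm-comm (t y₂) (t y₁)) lcm≡) y₂≡ (l≡v*y₁ sq) g∣y g∤d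

module PowerColumns {m} (t : Fin m → ℕ) (t-inc : StrictlyIncreasing t) (t-pos : Positive t)
  (gcd-closed : GcdClosed t) (condG : SetCondG t) (atMostTwo : ∀ j → GAtMostTwo t j)
  (a b : ℕ) (a>0 : 0 < a) (b>0 : 0 < b) (a∣b : a ∣ b) where

  open import Data.Nat as ℕ using (ℕ; _^_; _<_; _∸_; NonZero)
  import Data.Nat.Properties as ℕP
  import Data.Nat.DivMod as ℕDM
  open import Data.Nat.Divisibility as ℕ using (quotient; quotient>1)
  open ℕ._∣_ using (equality)
  open import Data.Integer.Divisibility.Signed renaming (_∣_ to _∣ℤ_)
  open import Data.Nat.LCM using (lcm; n∣lcm[m,n])
  open import Data.Nat.Tactic.RingSolver using () renaming (solve-∀ to ℕ-solve-∀)
  open import Data.Integer as ℤ using (ℤ; +_; 0ℤ; 1ℤ; -1ℤ; _+_; _-_; _*_)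
  import Data.Integer.Properties as ℤP
  open import Data.Integer.Tactic.RingSolver using () renaming (solve-∀ to ℤ-solve-∀)
  open import Data.Fin using (Fin)
  open import Data.Product using (∃; _×_; _,_)
  open import Relation.Binary.PropositionalEquality
  open import Data.Sum using (_⊎_; inj₁; inj₂)
  open import Relation.Nullary using (¬_; yes; no; contradiction)

  open ConditionG t t-inc t-pos gcd-closed condG atMostTwo
  open GcdMatrixInverse t t-inc t-pos möbiusColumns using (column; column-divides)

  minimal-closed : ∀ {l} (V : Fin m → ℤ) none → ⟪ columnOf {l} (minimal none) ∣ V ⟫ℤ ≡ V l
  minimal-closed {l} V _ = evaluate (V l)
    where
    evaluate : ∀ v → 1ℤ * v + 0ℤ ≡ v
    evaluate = ℤ-solve-∀

  module _ {l : Fin m} (V : Fin m → ℤ) {C : ℕ} (x : ℕ) where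

    chain-closed : ∀ {y} (y-gtd : IsGTD t y l) unique → V l ≡ + (C ℕ.* t l ^ x) → V y ≡ + (C ℕ.* t y ^ x) →
      ⟪ columnOf (chain y-gtd unique) ∣ V ⟫ℤ ≡ + (C ℕ.* t y ^ x) * (+ (quotient (gtd-∣ y-gtd) ^ x) - 1ℤ)
    chain-closed {y} y-gtd unique Vₗ≡ Vᵧ≡ = begin
      ⟪ columnOf (chain y-gtd unique) ∣ V ⟫ℤ  ≡⟨ ⟪chain∣⟫ℤ V l y ⟩
      V l - V y                              ≡⟨ cong₂ _-_ Vₗ≡ Vᵧ≡ ⟩
      + (C ℕ.* t l ^ x) - + K                ≡⟨ cong (λ n → + (C ℕ.* n ^ x) - + K) (equality (gtd-∣ y-gtd)) ⟩
      + (C ℕ.* (r ℕ.* t y) ^ x) - + K        ≡⟨ cong (λ n → + n - + K) (trans (cong (C ℕ.*_) (^-distribʳ-* r (t y) x)) (regroup C (r ^ x) (t y ^ x))) ⟩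
      + (K ℕ.* r ^ x) - + K                  ≡⟨ cong (_- + K) (ℤP.pos-* K (r ^ x)) ⟩
      + K * + (r ^ x) - + K                  ≡⟨ factor (+ K) (+ (r ^ x)) ⟩
      + K * (+ (r ^ x) - 1ℤ)                 ∎
      where
      open ≡-Reasoning
      r = quotient (gtd-∣ y-gtd)
      K = C ℕ.* t y ^ x
      regroup : ∀ c r y → c ℕ.* (r ℕ.* y) ≡ c ℕ.* y ℕ.* r
      regroup = ℕ-solve-∀
      factor : ∀ k r → k * r - k ≡ k * (r - 1ℤ)
      factor = ℤ-solve-∀

    square-closed : ∀ (sq : Square l) {S T} → let open Square sq in
      V l ≡ + (C ℕ.* t l ^ x) → V y₁ ≡ + (C ℕ.* S ℕ.* t y₁ ^ x) →
      V y₂ ≡ + (C ℕ.* T ℕ.* t y₂ ^ x) → V d ≡ + (C ℕ.* S ℕ.* T ℕ.* t d ^ x) →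
      ⟪ columnOf (square sq) ∣ V ⟫ℤ ≡ + (C ℕ.* t d ^ x) * ((+ (u ^ x) - + T) * (+ (v ^ x) - + S))
    square-closed sq {S} {T} Vₗ≡ Vy₁≡ Vy₂≡ Vd≡ = begin
      ⟪ columnOf (square sq) ∣ V ⟫ℤ                                  ≡⟨ ⟪square∣⟫ℤ V l y₁ y₂ d ⟩
      V l - V y₁ - V y₂ + V d                                        ≡⟨ cong₂ _+_ (cong₂ _-_ (cong₂ _-_ (trans Vₗ≡ l-value) (trans Vy₁≡ (y-value S u y₁≡)))
                                                                                             (trans Vy₂≡ (y-value T v y₂≡))) (trans Vd≡ d-value) ⟩
      + K * (+ U * + W) - + K * (+ S * + U) - + K * (+ T * + W) + + K * (+ S * + T)
                                                                     ≡⟨ factor (+ K) (+ U) (+ W) (+ S) (+ T) ⟩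
      + K * ((+ U - + T) * (+ W - + S))                              ∎
      where
      open Square sq
      open ≡-Reasoning
      K = C ℕ.* t d ^ x
      U = u ^ x
      W = v ^ x
      split : ∀ k p q → + (k ℕ.* (p ℕ.* q)) ≡ + k * (+ p * + q)
      split k p q = trans (ℤP.pos-* k (p ℕ.* q)) (cong (+ k *_) (ℤP.pos-* p q))
      l-value : + (C ℕ.* t l ^ x) ≡ + K * (+ U * + W)
      l-value = trans (cong (λ n → + (C ℕ.* n ^ x)) l≡)
        (trans (cong (λ n → + (C ℕ.* n)) (trans (^-distribʳ-* (u ℕ.* v) (t d) x) (cong (ℕ._* t d ^ x) (^-distribʳ-* u v x))))
        (trans (cong +_ (regroup C U W (t d ^ x))) (split K U W)))
        where
        regroup : ∀ c u v e → c ℕ.* (u ℕ.* v ℕ.* e) ≡ c ℕ.* e ℕ.* (u ℕ.* v)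
        regroup = ℕ-solve-∀
      y-value : ∀ {y} s q → t y ≡ q ℕ.* t d → + (C ℕ.* s ℕ.* t y ^ x) ≡ + K * (+ s * + (q ^ x))
      y-value s q tᵧ≡ = trans (cong (λ n → + (C ℕ.* s ℕ.* n ^ x)) tᵧ≡)
        (trans (cong (λ n → + (C ℕ.* s ℕ.* n)) (^-distribʳ-* q (t d) x)) (trans (cong +_ (regroup C s (q ^ x) (t d ^ x))) (split K s (q ^ x))))
        where
        regroup : ∀ c s q e → c ℕ.* s ℕ.* (q ℕ.* e) ≡ c ℕ.* e ℕ.* (s ℕ.* q)
        regroup = ℕ-solve-∀
      d-value : + (C ℕ.* S ℕ.* T ℕ.* t d ^ x) ≡ + K * (+ S * + T)
      d-value = trans (cong +_ (regroup C S T (t d ^ x))) (split K S T)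
        where
        regroup : ∀ c s u e → c ℕ.* s ℕ.* u ℕ.* e ≡ c ℕ.* e ℕ.* (s ℕ.* u)
        regroup = ℕ-solve-∀
      factor : ∀ k u w s r → k * (u * w) - k * (s * u) - k * (r * w) + k * (s * r) ≡ k * ((u - r) * (w - s))
      factor = ℤ-solve-∀

  private
    t^>0 : ∀ p x → 0 < t p ^ x
    t^>0 p x = ℕP.m^n>0 (t p) {{ℕ.>-nonZero (t-pos p)}} x

    ^>1 : ∀ {u} → 1 < u → 1 < u ^ a
    ^>1 {u} 1<u = ℕP.<-≤-trans 1<u (subst (ℕ._≤ u ^ a) (ℕP.^-identityʳ u) (ℕP.^-monoʳ-≤ u {{ℕ.>-nonZero (ℕP.<-trans ℕP.0<1+n 1<u)}} a>0))

    a≤b : a ℕ.≤ b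
    a≤b = ℕ.∣⇒≤ {{ℕ.>-nonZero b>0}} a∣b

    one* : ∀ n → + n ≡ + (1 ℕ.* n)
    one* n = cong +_ (sym (ℕP.*-identityˡ n))

    [u^a-1]∣[u^x-τ^b] : ∀ {u τ} x → a ℕ.∣ x → τ ≡ 1 ⊎ τ ≡ u → + (u ^ a) - 1ℤ ∣ℤ + (u ^ x) - + (τ ^ b)
    [u^a-1]∣[u^x-τ^b] {u} x a∣x (inj₁ refl) =
      subst (λ n → + (u ^ a) - 1ℤ ∣ℤ + (u ^ x) - + n) (sym (ℕP.^-zeroˡ b)) ([x^a-1]∣[x^m-x^n] u a∣x (a ℕ.∣0))
    [u^a-1]∣[u^x-τ^b] {u} x a∣x (inj₂ refl) = [x^a-1]∣[x^m-x^n] u a∣x a∣b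

    1*n^a∣k*n^b : ∀ k n → 1 ℕ.* n ^ a ℕ.∣ k ℕ.* n ^ b
    1*n^a∣k*n^b k n = ℕ.∣-trans (ℕ.∣-reflexive (ℕP.*-identityˡ (n ^ a))) (ℕ.∣-trans (^-monoʳ-∣ n a≤b) (ℕ.n∣m*n k))

  powers : ℕ → Fin m → ℤ
  powers x p = + (t p ^ x)

  αℤ : ℕ → Fin m → ℤ
  αℤ x l = ⟪ column l ∣ powers x ⟫ℤ

  powers-chain : ∀ x {l y} (y-gtd : IsGTD t y l) unique →
    ⟪ columnOf (chain y-gtd unique) ∣ powers x ⟫ℤ ≡ + (1 ℕ.* t y ^ x) * (+ (quotient (gtd-∣ y-gtd) ^ x) - 1ℤ)
  powers-chain x y-gtd unique = chain-closed (powers x) {C = 1} x y-gtd unique (one* _) (one* _)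

  powers-square : ∀ x {l} (sq : Square l) → let open Square sq in
    ⟪ columnOf (square sq) ∣ powers x ⟫ℤ ≡ + (1 ℕ.* t d ^ x) * ((+ (u ^ x) - 1ℤ) * (+ (v ^ x) - 1ℤ))
  powers-square x sq = square-closed (powers x) {C = 1} x sq {1} {1} (one* _) (one* _) (one* _) (one* _)

  αℤ≢0 : ∀ l → αℤ a l ≢ 0ℤ
  αℤ≢0 l = nonzero-at (shape l)
    where
    nonzero-at : (s : Shape l) → ⟪ columnOf s ∣ powers a ⟫ℤ ≢ 0ℤ
    nonzero-at (minimal none) = subst (_≢ 0ℤ) (sym (minimal-closed (powers a) none)) (+≢0 (t^>0 l a))
    nonzero-at (chain {y} y-gtd unique) = subst (_≢ 0ℤ) (sym (powers-chain a y-gtd unique))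
      (*-≢0 (+≢0 (subst (0 <_) (sym (ℕP.*-identityˡ _)) (t^>0 y a))) (+-1≢0 (^>1 (quotient>1 (gtd-∣ y-gtd) (gtd-< y-gtd)))))
    nonzero-at (square sq) = subst (_≢ 0ℤ) (sym (powers-square a sq))
      (*-≢0 (+≢0 (subst (0 <_) (sym (ℕP.*-identityˡ _)) (t^>0 d a))) (*-≢0 (+-1≢0 (^>1 1<u)) (+-1≢0 (^>1 1<v))))
      where open Square sq

  αℤ∣αℤ : ∀ l → αℤ a l ∣ℤ αℤ b l
  αℤ∣αℤ l = divides-at (shape l)
    where
    divides-at : (s : Shape l) → ⟪ columnOf s ∣ powers a ⟫ℤ ∣ℤ ⟪ columnOf s ∣ powers b ⟫ℤ
    divides-at (minimal none) = subst₂ _∣ℤ_ (sym (minimal-closed (powers a) none)) (sym (minimal-closed (powers b) none))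
      (pos-∣ (^-monoʳ-∣ (t l) a≤b))
    divides-at (chain {y} y-gtd unique) =
      subst₂ _∣ℤ_ (sym (powers-chain a y-gtd unique)) (sym (powers-chain b y-gtd unique))
        (*-pres-∣ (pos-∣ (ℕ.*-monoʳ-∣ 1 (^-monoʳ-∣ (t y) a≤b))) ([x^a-1]∣[x^m-x^n] (quotient (gtd-∣ y-gtd)) a∣b (a ℕ.∣0)))
    divides-at (square sq) =
      subst₂ _∣ℤ_ (sym (powers-square a sq)) (sym (powers-square b sq))
        (*-pres-∣ (pos-∣ (ℕ.*-monoʳ-∣ 1 (^-monoʳ-∣ (t d) a≤b)))
                  (*-pres-∣ ([x^a-1]∣[x^m-x^n] u a∣b (a ℕ.∣0)) ([x^a-1]∣[x^m-x^n] v a∣b (a ℕ.∣0))))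
      where open Square sq

  κ : Fin m → Fin m → ℕ
  κ i p = quotient (n∣lcm[m,n] (t i) (t p))

  private
    κ-unique : ∀ {i p c} → lcm (t i) (t p) ≡ c ℕ.* t p → κ i p ≡ c
    κ-unique {i} {p} {c} lcm≡ = ℕP.*-cancelʳ-≡ (κ i p) c (t p) {{ℕ.>-nonZero (t-pos p)}}
      (trans (sym (equality (n∣lcm[m,n] (t i) (t p)))) lcm≡)

  cofactorPowers : ℕ → Fin m → Fin m → ℤ
  cofactorPowers x i p = + (κ i p ^ b ℕ.* t p ^ x)

  module _ {i l} (tₗ∤tᵢ : ¬ t l ℕ.∣ t i) (x : ℕ) where

    cofactors-chain : ∀ {y} (y-gtd : IsGTD t y l) unique →
      ⟪ columnOf (chain y-gtd unique) ∣ cofactorPowers x i ⟫ℤ ≡ + (κ i l ^ b ℕ.* t y ^ x) * (+ (quotient (gtd-∣ y-gtd) ^ x) - 1ℤ)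
    cofactors-chain {y} y-gtd unique =
      chain-closed (cofactorPowers x i) {C = κ i l ^ b} x y-gtd unique refl (value (chain-lcm tₗ∤tᵢ y-gtd unique))
      where
      value : (∃ λ c → lcm (t i) (t l) ≡ c ℕ.* t l × lcm (t i) (t y) ≡ c ℕ.* t y) → cofactorPowers x i y ≡ + (κ i l ^ b ℕ.* t y ^ x)
      value (c , lcm-l , lcm-y) = cong (λ k → + (k ^ b ℕ.* t y ^ x)) (trans (κ-unique {c = c} lcm-y) (sym (κ-unique {c = c} lcm-l)))

    cofactors-square : ∀ (sq : Square l) → let open Square sq in let open SquareLcm (square-lcm tₗ∤tᵢ sq) in
      ⟪ columnOf (square sq) ∣ cofactorPowers x i ⟫ℤ ≡ + (c ^ b ℕ.* t d ^ x) * ((+ (u ^ x) - + (τ ^ b)) * (+ (v ^ x) - + (σ ^ b)))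
    cofactors-square sq = square-closed (cofactorPowers x i) {C = c ^ b} x sq {σ ^ b} {τ ^ b}
      (value₁ lcm-l) (value₂ lcm-y₁) (value₂ lcm-y₂) (value₃ lcm-d)
      where
      open Square sq
      open SquareLcm (square-lcm tₗ∤tᵢ sq)
      value₁ : ∀ {p} → lcm (t i) (t p) ≡ c ℕ.* t p → cofactorPowers x i p ≡ + (c ^ b ℕ.* t p ^ x)
      value₁ lcm≡ = cong (λ k → + (k ^ b ℕ.* _)) (κ-unique lcm≡)
      value₂ : ∀ {p s} → lcm (t i) (t p) ≡ c ℕ.* s ℕ.* t p → cofactorPowers x i p ≡ + (c ^ b ℕ.* s ^ b ℕ.* t p ^ x)
      value₂ {s = s} lcm≡ = cong (λ k → + (k ℕ.* _)) (trans (cong (_^ b) (κ-unique lcm≡)) (^-distribʳ-* c s b))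
      value₃ : ∀ {p} → lcm (t i) (t p) ≡ c ℕ.* σ ℕ.* τ ℕ.* t p → cofactorPowers x i p ≡ + (c ^ b ℕ.* σ ^ b ℕ.* τ ^ b ℕ.* t p ^ x)
      value₃ lcm≡ = cong (λ k → + (k ℕ.* _))
        (trans (cong (_^ b) (κ-unique lcm≡)) (trans (^-distribʳ-* (c ℕ.* σ) τ b) (cong (ℕ._* τ ^ b) (^-distribʳ-* c σ b))))

  αℤ∣lcm-column : ∀ i l → αℤ a l ∣ℤ ⟪ column l ∣ (λ p → + (lcm (t i) (t p) ^ b)) ⟫ℤ
  αℤ∣lcm-column i l with t l ℕ.∣? t i
  ... | yes tₗ∣tᵢ = subst (αℤ a l ∣ℤ_) (sym (⟪∣⟫ℤ-cong (column l) (column-divides l) lcm≡tᵢ)) (constant (shape l))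
    where
    lcm≡tᵢ : ∀ p → t p ℕ.∣ t l → + (lcm (t i) (t p) ^ b) ≡ + (t i ^ b)
    lcm≡tᵢ p tₚ∣tₗ = cong (λ n → + (n ^ b)) (lcm-of-divisor (ℕ.∣-trans tₚ∣tₗ tₗ∣tᵢ))
    T = + (t i ^ b)
    constant : (s : Shape l) → ⟪ columnOf s ∣ powers a ⟫ℤ ∣ℤ ⟪ columnOf s ∣ (λ _ → T) ⟫ℤ
    constant (minimal none) = subst₂ _∣ℤ_ (sym (minimal-closed (powers a) none)) (sym (minimal-closed (λ _ → T) none))
      (pos-∣ (ℕ.∣-trans (^-monoˡ-∣ a tₗ∣tᵢ) (^-monoʳ-∣ (t i) a≤b)))
    constant (chain {y} _ _) = subst (_ ∣ℤ_) (sym (trans (⟪chain∣⟫ℤ (λ _ → T) l y) (ℤP.+-inverseʳ T))) (divides 0ℤ refl)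
    constant (square sq) = subst (_ ∣ℤ_) (sym (trans (⟪square∣⟫ℤ (λ _ → T) l y₁ y₂ d) (cancel T))) (divides 0ℤ refl)
      where
      open Square sq
      cancel : ∀ z → z - z - z + z ≡ 0ℤ
      cancel = ℤ-solve-∀
  ... | no tₗ∤tᵢ = subst (αℤ a l ∣ℤ_) (sym (⟪∣⟫ℤ-cong (column l) (column-divides l) lcm^b≡)) (cofactor (shape l))
    where
    lcm^b≡ : ∀ p → t p ℕ.∣ t l → + (lcm (t i) (t p) ^ b) ≡ cofactorPowers b i p
    lcm^b≡ p _ = cong +_ (trans (cong (_^ b) (equality (n∣lcm[m,n] (t i) (t p)))) (^-distribʳ-* (κ i p) (t p) b))
    cofactor : (s : Shape l) → ⟪ columnOf s ∣ powers a ⟫ℤ ∣ℤ ⟪ columnOf s ∣ cofactorPowers b i ⟫ℤ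
    cofactor (minimal none) = contradiction (GcdBelow.y-gtd (gcd-below tₗ∤tᵢ)) (none _)
    cofactor (chain {y} y-gtd unique) = subst₂ _∣ℤ_ (sym (powers-chain a y-gtd unique)) (sym (cofactors-chain tₗ∤tᵢ b y-gtd unique))
      (*-pres-∣ (pos-∣ (1*n^a∣k*n^b (κ i l ^ b) (t y))) ([x^a-1]∣[x^m-x^n] (quotient (gtd-∣ y-gtd)) a∣b (a ℕ.∣0)))
    cofactor (square sq) = subst₂ _∣ℤ_ (sym (powers-square a sq)) (sym (cofactors-square tₗ∤tᵢ b sq))
      (*-pres-∣ (pos-∣ (1*n^a∣k*n^b (c ^ b) (t d))) (*-pres-∣ ([u^a-1]∣[u^x-τ^b] b a∣b τ-cases) ([u^a-1]∣[u^x-τ^b] b a∣b σ-cases)))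
      where
      open Square sq
      open SquareLcm (square-lcm tₗ∤tᵢ sq)

  private instance
    t≢0 : ∀ {p} → NonZero (t p)
    t≢0 {p} = ℕ.>-nonZero (t-pos p)

  ratio : Fin m → Fin m → ℕ
  ratio l p = t l ℕ./ t p

  ratio≡ : ∀ {l p q} → t l ≡ q ℕ.* t p → ratio l p ≡ q
  ratio≡ {l} {p} {q} tₗ≡ = trans (cong (ℕ._/ t p) tₗ≡) (ℕDM.m*n/n≡m q (t p))

  βℤ : Fin m → ℤ
  βℤ l = ⟪ column l ∣ (λ p → + (ratio l p ^ a)) ⟫ℤ

  private
    ratioₗₗ : ∀ l → + (ratio l l ^ a) ≡ 1ℤ
    ratioₗₗ l = cong +_ (trans (cong (_^ a) (ℕDM.n/n≡1 (t l))) (ℕP.^-zeroˡ a))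

    β-chain : ∀ {l y} (y-gtd : IsGTD t y l) unique →
      ⟪ columnOf (chain y-gtd unique) ∣ (λ p → + (ratio l p ^ a)) ⟫ℤ ≡ 1ℤ - + (quotient (gtd-∣ y-gtd) ^ a)
    β-chain {l} {y} y-gtd _ = trans (⟪chain∣⟫ℤ (λ p → + (ratio l p ^ a)) l y)
      (cong₂ _-_ (ratioₗₗ l) (cong (λ q → + (q ^ a)) (ratio≡ (equality (gtd-∣ y-gtd)))))

    β-square : ∀ {l} (sq : Square l) → let open Square sq in
      ⟪ columnOf (square sq) ∣ (λ p → + (ratio l p ^ a)) ⟫ℤ ≡ (+ (u ^ a) - 1ℤ) * (+ (v ^ a) - 1ℤ)
    β-square {l} sq = begin
      ⟪ columnOf (square sq) ∣ R ⟫ℤ                      ≡⟨ ⟪square∣⟫ℤ R l y₁ y₂ d ⟩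
      R l - R y₁ - R y₂ + R d                            ≡⟨ cong₂ _+_ (cong₂ _-_ (cong₂ _-_ (ratioₗₗ l) (R≡ (l≡v*y₁ sq))) (R≡ (l≡u*y₂ sq))) Rd≡ ⟩
      1ℤ - + (v ^ a) - + (u ^ a) + + (u ^ a) * + (v ^ a) ≡⟨ factor (+ (u ^ a)) (+ (v ^ a)) ⟩
      (+ (u ^ a) - 1ℤ) * (+ (v ^ a) - 1ℤ)                ∎
      where
      open Square sq
      open ≡-Reasoning
      R : Fin m → ℤ
      R p = + (ratio l p ^ a)
      R≡ : ∀ {p q} → t l ≡ q ℕ.* t p → R p ≡ + (q ^ a)
      R≡ tₗ≡ = cong (λ q → + (q ^ a)) (ratio≡ tₗ≡)
      Rd≡ : R d ≡ + (u ^ a) * + (v ^ a)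
      Rd≡ = trans (R≡ l≡) (trans (cong +_ (^-distribʳ-* u v a)) (ℤP.pos-* (u ^ a) (v ^ a)))
      factor : ∀ x y → 1ℤ - y - x + x * y ≡ (x - 1ℤ) * (y - 1ℤ)
      factor = ℤ-solve-∀

  βℤ≢0 : ∀ l → βℤ l ≢ 0ℤ
  βℤ≢0 l = nonzero-at (shape l)
    where
    nonzero-at : (s : Shape l) → ⟪ columnOf s ∣ (λ p → + (ratio l p ^ a)) ⟫ℤ ≢ 0ℤ
    nonzero-at (minimal none) = subst (_≢ 0ℤ) (sym (trans (minimal-closed (λ p → + (ratio l p ^ a)) none) (ratioₗₗ l))) λ ()
    nonzero-at (chain y-gtd unique) = subst (_≢ 0ℤ) (sym (β-chain y-gtd unique))
      (λ 1-rᵃ≡0 → +-1≢0 (^>1 (quotient>1 (gtd-∣ y-gtd) (gtd-< y-gtd))) (trans (negate (+ (quotient (gtd-∣ y-gtd) ^ a))) (cong ℤ.-_ 1-rᵃ≡0)))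
      where
      negate : ∀ z → z - 1ℤ ≡ ℤ.- (1ℤ - z)
      negate = ℤ-solve-∀
    nonzero-at (square sq) = subst (_≢ 0ℤ) (sym (β-square sq)) (*-≢0 (+-1≢0 (^>1 1<u)) (+-1≢0 (^>1 1<v)))
      where open Square sq

  βℤ∣cofactor-column : ∀ i l → ¬ t l ℕ.∣ t i → βℤ l ∣ℤ ⟪ column l ∣ cofactorPowers (b ∸ a) i ⟫ℤ
  βℤ∣cofactor-column i l tₗ∤tᵢ = cofactor (shape l)
    where
    a∣e : a ℕ.∣ b ∸ a
    a∣e = ∣m∣n⇒∣m∸n a∣b ℕ.∣-refl
    cofactor : (s : Shape l) → ⟪ columnOf s ∣ (λ p → + (ratio l p ^ a)) ⟫ℤ ∣ℤ ⟪ columnOf s ∣ cofactorPowers (b ∸ a) i ⟫ℤ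
    cofactor (minimal none) = contradiction (GcdBelow.y-gtd (gcd-below tₗ∤tᵢ)) (none _)
    cofactor (chain {y} y-gtd unique) = subst₂ _∣ℤ_ (sym (β-chain y-gtd unique)) (sym (cofactors-chain tₗ∤tᵢ (b ∸ a) y-gtd unique))
      (∣n⇒∣m*n (+ (κ i l ^ b ℕ.* t y ^ (b ∸ a))) (∣-trans (divides -1ℤ (flip (+ (r ^ a)))) ([x^a-1]∣[x^m-x^n] r a∣e (a ℕ.∣0))))
      where
      r = quotient (gtd-∣ y-gtd)
      flip : ∀ z → z - 1ℤ ≡ -1ℤ * (1ℤ - z)
      flip = ℤ-solve-∀
    cofactor (square sq) = subst₂ _∣ℤ_ (sym (β-square sq)) (sym (cofactors-square tₗ∤tᵢ (b ∸ a) sq))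
      (∣n⇒∣m*n (+ (c ^ b ℕ.* t d ^ (b ∸ a))) (*-pres-∣ ([u^a-1]∣[u^x-τ^b] (b ∸ a) a∣e τ-cases) ([u^a-1]∣[u^x-τ^b] (b ∸ a) a∣e σ-cases)))
      where
      open Square sq
      open SquareLcm (square-lcm tₗ∤tᵢ sq)

module PowerMatrices {m} (t : Fin m → ℕ) (t-inc : StrictlyIncreasing t) (t-pos : Positive t)
  (gcd-closed : GcdClosed t) (condG : SetCondG t) (atMostTwo : ∀ j → GAtMostTwo t j)
  (a b : ℕ) (a>0 : 0 < a) (b>0 : 0 < b) (a∣b : a ∣ b) where

  open import Data.Nat as ℕ using (ℕ; _^_; _<_; _∸_; NonZero)
  import Data.Nat.Properties as ℕP
  import Data.Nat.DivMod as ℕDM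
  open import Data.Nat.Divisibility as ℕ using (_∣?_; ∣-trans)
  open import Data.Nat.GCD using (gcd; gcd[m,n]≢0)
  open import Data.Sum using (inj₁)
  open import Data.Nat.LCM using (lcm; n∣lcm[m,n]; gcd*lcm)
  open ℕ._∣_ using (equality)
  open import Data.Integer using (+_; 0ℤ)
  import Data.Integer.Properties as ℤP
  open import Data.Fin using (Fin)
  import Data.Fin.Properties as FP
  open import Data.Rational using (ℚ; 0ℚ; 1ℚ; _+_; _*_)
  import Data.Rational.Properties as ℚP
  open import Data.Product using (_,_)
  open import Function using (_∘_)
  open import Relation.Binary.PropositionalEquality
  open import Data.Rational.Solver using (module +-*-Solver)
  open +-*-Solver using (solve; _:*_; con; _:=_)
  open import Relation.Nullary using (yes; no)

  open ConditionG t t-inc t-pos gcd-closed condG atMostTwo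
  open GcdMatrixInverse t t-inc t-pos möbiusColumns
  open PowerColumns t t-inc t-pos gcd-closed condG atMostTwo a b a>0 b>0 a∣b

  power : ℕ → ℕ → ℚ
  power x z = ℕ→ℚ (z ^ x)

  private
    a≤b : a ℕ.≤ b
    a≤b = ℕ.∣⇒≤ {{ℕ.>-nonZero b>0}} a∣b

    power-t≢0 : ∀ x p → power x (t p) ≢ 0ℚ
    power-t≢0 x p = ℤ→ℚ-nonZero (+≢0 (ℕP.m^n>0 (t p) {{ℕ.>-nonZero (t-pos p)}} x))

    α≡αℤ : ∀ x l → ⟪ column l ∣ power x ∘ t ⟫ ≡ ℤ→ℚ (αℤ x l)
    α≡αℤ x l = ⟪∣⟫-ℤ→ℚ (powers x) (column l)

  module GcdInverse = Unweighted (power a) (λ l → subst (_≢ 0ℚ) (sym (α≡αℤ a l)) (ℤ→ℚ-nonZero (αℤ≢0 l)))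

  gcd-integral : MulInvIntegral (gcdMat t b) (gcdMat t a)
  gcd-integral = X , isInverse (λ i k → sym (ℚP.*-identityˡ _)) , isIntegral-⊗X (gcdMat t b) column-integral
    where
    open GcdInverse
    column-integral : ∀ i l → IsInteger (⟪ column l ∣ gcdMat t b i ⟫ * α l ⁻¹)
    column-integral i l with t l ∣? t i
    ... | yes tₗ∣tᵢ = subst IsInteger (sym (cong₂ (λ p q → p * q ⁻¹) (trans (column-gcd-∣ (power b) tₗ∣tᵢ) (α≡αℤ b l)) (α≡αℤ a l)))
                        (isInteger-÷ (αℤ≢0 l) (αℤ∣αℤ l))
    ... | no  tₗ∤tᵢ = subst (λ q → IsInteger (q * α l ⁻¹)) (sym (column-vanishes l i (power b) tₗ∤tᵢ))
                        (subst IsInteger (sym (ℚP.*-zeroˡ (α l ⁻¹))) (isInteger-ℤ→ℚ 0ℤ))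

  lcm-gcd-integral : MulInvIntegral (lcmMat t b) (gcdMat t a)
  lcm-gcd-integral = X , isInverse (λ i k → sym (ℚP.*-identityˡ _)) , isIntegral-⊗X (lcmMat t b) column-integral
    where
    open GcdInverse
    column-integral : ∀ i l → IsInteger (⟪ column l ∣ lcmMat t b i ⟫ * α l ⁻¹)
    column-integral i l = subst IsInteger (sym (cong₂ (λ p q → p * q ⁻¹) (⟪∣⟫-ℤ→ℚ (λ p → + (lcm (t i) (t p) ^ b)) (column l)) (α≡αℤ a l)))
                            (isInteger-÷ (αℤ≢0 l) (αℤ∣lcm-column i l))

  private
    w : Fin m → ℚ
    w p = power a (t p)

    reciprocal : ℕ → ℚ
    reciprocal z = (power a z) ⁻¹

    w-quotient : ∀ {p l} → t p ℕ.∣ t l → IsInteger (w l * w p ⁻¹)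
    w-quotient {p} tₚ∣tₗ = isInteger-÷ (+≢0 (ℕP.m^n>0 (t p) {{ℕ.>-nonZero (t-pos p)}} a)) (pos-∣ (^-monoˡ-∣ a tₚ∣tₗ))

    αw≡βℤ : ∀ l → ⟪ column l ∣ reciprocal ∘ t ⟫ * w l ≡ ℤ→ℚ (βℤ l)
    αw≡βℤ l = begin
      ⟪ column l ∣ reciprocal ∘ t ⟫ * w l                 ≡⟨ ⟪∣⟫-*ʳ (reciprocal ∘ t) (w l) (column l) ⟨
      ⟪ column l ∣ (λ p → reciprocal (t p) * w l) ⟫       ≡⟨ ⟪∣⟫-cong (column l) (column-divides l) ratio-term ⟩
      ⟪ column l ∣ (λ p → ℤ→ℚ (+ (ratio l p ^ a))) ⟫      ≡⟨ ⟪∣⟫-ℤ→ℚ (λ p → + (ratio l p ^ a)) (column l) ⟩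
      ℤ→ℚ (βℤ l)                                         ∎
      where
      open ≡-Reasoning
      ratio-term : ∀ p → t p ℕ.∣ t l → reciprocal (t p) * w l ≡ ℤ→ℚ (+ (ratio l p ^ a))
      ratio-term p tₚ∣tₗ = trans (ℚP.*-comm (reciprocal (t p)) (w l))
        (ℤ→ℚ-÷ (+ (ratio l p ^ a)) (+≢0 (ℕP.m^n>0 (t p) {{ℕ.>-nonZero (t-pos p)}} a))
          (trans (cong +_ (trans (cong (_^ a) (sym (ℕDM.m/n*n≡m {{ℕ.>-nonZero (t-pos p)}} tₚ∣tₗ))) (^-distribʳ-* (ratio l p) (t p) a)))
                 (ℤP.pos-* (ratio l p ^ a) (t p ^ a))))

    α≢0 : ∀ l → ⟪ column l ∣ reciprocal ∘ t ⟫ ≢ 0ℚ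
    α≢0 l α≡0 = ℤ→ℚ-nonZero (βℤ≢0 l) (trans (sym (αw≡βℤ l)) (trans (cong (_* w l) α≡0) (ℚP.*-zeroˡ (w l))))

    lcm^a≡ : ∀ i k → lcmMat t a i k ≡ w i * w k * reciprocal (gcd (t i) (t k))
    lcm^a≡ i k = sym (begin
      w i * w k * reciprocal g                  ≡⟨ cong (_* reciprocal g) (ℕ→ℚ-homo-* (t i ^ a) (t k ^ a)) ⟨
      ℕ→ℚ (t i ^ a ℕ.* t k ^ a) * reciprocal g  ≡⟨ ℤ→ℚ-÷ (+ (lcm (t i) (t k) ^ a)) (+≢0 (ℕP.m^n>0 g {{g≢0}} a))
                                                   (trans (cong +_ product) (ℤP.pos-* (lcm (t i) (t k) ^ a) (g ^ a))) ⟩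
      lcmMat t a i k                            ∎)
      where
      open ≡-Reasoning
      g = gcd (t i) (t k)
      g≢0 : NonZero g
      g≢0 = ℕ.≢-nonZero (gcd[m,n]≢0 (t i) (t k) (inj₁ (ℕP.n>0⇒n≢0 (t-pos i))))
      product : t i ^ a ℕ.* t k ^ a ≡ lcm (t i) (t k) ^ a ℕ.* g ^ a
      product = begin
        t i ^ a ℕ.* t k ^ a                     ≡⟨ ^-distribʳ-* (t i) (t k) a ⟨
        (t i ℕ.* t k) ^ a                       ≡⟨ cong (_^ a) (gcd*lcm (t i) (t k)) ⟨
        (g ℕ.* lcm (t i) (t k)) ^ a             ≡⟨ cong (_^ a) (ℕP.*-comm g (lcm (t i) (t k))) ⟩
        (lcm (t i) (t k) ℕ.* g) ^ a             ≡⟨ ^-distribʳ-* (lcm (t i) (t k)) g a ⟩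
        lcm (t i) (t k) ^ a ℕ.* g ^ a           ∎

  module LcmInverse = Weighted w (power-t≢0 a) reciprocal α≢0

  private
    open LcmInverse using (α)

    lcm^b/w≡cofactorPowers : ∀ i p → lcmMat t b i p * w p ⁻¹ ≡ ℤ→ℚ (cofactorPowers (b ∸ a) i p)
    lcm^b/w≡cofactorPowers i p = ℤ→ℚ-÷ (cofactorPowers (b ∸ a) i p) (+≢0 (ℕP.m^n>0 (t p) {{ℕ.>-nonZero (t-pos p)}} a))
      (trans (cong +_ split) (ℤP.pos-* (κ i p ^ b ℕ.* t p ^ (b ∸ a)) (t p ^ a)))
      where
      open ≡-Reasoning
      split : lcm (t i) (t p) ^ b ≡ κ i p ^ b ℕ.* t p ^ (b ∸ a) ℕ.* t p ^ a
      split = begin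
        lcm (t i) (t p) ^ b                       ≡⟨ cong (_^ b) (equality (n∣lcm[m,n] (t i) (t p))) ⟩
        (κ i p ℕ.* t p) ^ b                       ≡⟨ ^-distribʳ-* (κ i p) (t p) b ⟩
        κ i p ^ b ℕ.* t p ^ b                     ≡⟨ cong (λ x → κ i p ^ b ℕ.* t p ^ x) (ℕP.m∸n+n≡m a≤b) ⟨
        κ i p ^ b ℕ.* t p ^ (b ∸ a ℕ.+ a)         ≡⟨ cong (κ i p ^ b ℕ.*_) (ℕP.^-distribˡ-+-* (t p) (b ∸ a) a) ⟩
        κ i p ^ b ℕ.* (t p ^ (b ∸ a) ℕ.* t p ^ a) ≡⟨ ℕP.*-assoc (κ i p ^ b) (t p ^ (b ∸ a)) (t p ^ a) ⟨
        κ i p ^ b ℕ.* t p ^ (b ∸ a) ℕ.* t p ^ a   ∎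

    lcm-column-∣ : ∀ {i l} → t l ℕ.∣ t i →
      ⟪ column l ∣ (λ p → lcmMat t b i p * w p ⁻¹) ⟫ * (α l * w l) ⁻¹ ≡ power b (t i) * w l ⁻¹
    lcm-column-∣ {i} {l} tₗ∣tᵢ = begin
      ⟪ column l ∣ (λ p → lcmMat t b i p * w p ⁻¹) ⟫ * (α l * w l) ⁻¹
        ≡⟨ cong (_* (α l * w l) ⁻¹) (⟪∣⟫-cong (column l) (column-divides l)
             (λ p tₚ∣tₗ → cong (λ n → power b n * w p ⁻¹) (lcm-of-divisor (∣-trans tₚ∣tₗ tₗ∣tᵢ)))) ⟩
      ⟪ column l ∣ (λ p → T * reciprocal (t p)) ⟫ * (α l * w l) ⁻¹
        ≡⟨ cong₂ _*_ (⟪∣⟫-*ˡ T (reciprocal ∘ t) (column l)) (⁻¹-distrib-* (α≢0 l) (power-t≢0 a l)) ⟩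
      T * α l * (α l ⁻¹ * w l ⁻¹)      ≡⟨ regroup T (α l) (α l ⁻¹) (w l ⁻¹) ⟩
      T * w l ⁻¹ * (α l * α l ⁻¹)      ≡⟨ cong (T * w l ⁻¹ *_) (⁻¹-inverseʳ (α≢0 l)) ⟩
      T * w l ⁻¹ * 1ℚ                  ≡⟨ ℚP.*-identityʳ (T * w l ⁻¹) ⟩
      T * w l ⁻¹                       ∎
      where
      open ≡-Reasoning
      T = power b (t i)
      regroup : ∀ x y u v → x * y * (u * v) ≡ x * v * (y * u)
      regroup = solve 4 (λ x y u v → x :* y :* (u :* v) := x :* v :* (y :* u)) refl

    lcm-column-integral : ∀ i l → IsInteger (⟪ column l ∣ (λ p → lcmMat t b i p * w p ⁻¹) ⟫ * (α l * w l) ⁻¹)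
    lcm-column-integral i l with t l ∣? t i
    ... | yes tₗ∣tᵢ = subst IsInteger (sym (lcm-column-∣ tₗ∣tᵢ))
                        (isInteger-÷ (+≢0 (ℕP.m^n>0 (t l) {{ℕ.>-nonZero (t-pos l)}} a))
                                     (pos-∣ (∣-trans (^-monoˡ-∣ a tₗ∣tᵢ) (^-monoʳ-∣ (t i) a≤b))))
    ... | no  tₗ∤tᵢ = subst IsInteger (sym (cong₂ (λ p q → p * q ⁻¹) numerator (αw≡βℤ l)))
                        (isInteger-÷ (βℤ≢0 l) (βℤ∣cofactor-column i l tₗ∤tᵢ))
      where
      numerator : ⟪ column l ∣ (λ p → lcmMat t b i p * w p ⁻¹) ⟫ ≡ ℤ→ℚ ⟪ column l ∣ cofactorPowers (b ∸ a) i ⟫ℤ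
      numerator = trans (⟪∣⟫-cong (column l) (column-divides l) (λ p _ → lcm^b/w≡cofactorPowers i p))
                        (⟪∣⟫-ℤ→ℚ (cofactorPowers (b ∸ a) i) (column l))

    μ-weighted-integral : ∀ j l → IsInteger (μ j l * w l * w j ⁻¹)
    μ-weighted-integral j l = subst IsInteger (sym (trans (ℚP.*-assoc (μ j l) (w l) (w j ⁻¹)) (sym (⟪∣⟫-*ʳ (δ j) (w l * w j ⁻¹) (column l)))))
                       (isInteger-⟪∣⟫ (column l) (column-divides l) entry)
      where
      entry : ∀ p → t p ℕ.∣ t l → IsInteger (δ j p * (w l * w j ⁻¹))
      entry p tₚ∣tₗ with j FP.≟ p
      ... | yes refl = subst IsInteger (sym (trans (cong (_* (w l * w j ⁻¹)) (δ-diag j)) (ℚP.*-identityˡ (w l * w j ⁻¹)))) (w-quotient tₚ∣tₗ)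
      ... | no  j≢p  = subst IsInteger (sym (trans (cong (_* (w l * w j ⁻¹)) (δ-≢ j p j≢p)) (ℚP.*-zeroˡ (w l * w j ⁻¹)))) (isInteger-ℤ→ℚ 0ℤ)

  lcm-integral : MulInvIntegral (lcmMat t b) (lcmMat t a)
  lcm-integral = X , isInverse lcm^a≡ , isIntegral-⊗X (lcmMat t b) lcm-column-integral μ-weighted-integral
    where open LcmInverse

module Restriction {n} (x : Fin (suc n) → ℕ) (x-inc : StrictlyIncreasing x) (x-pos : Positive x)
  (gcd-closed : GcdClosed x) (condG : SetCondG x) (atMostTwo : ∀ j → GAtMostTwo x j) where

  open import Data.Nat as ℕ using (ℕ; suc; _<_; _≤_)
  import Data.Nat.Properties as ℕP
  open import Data.Nat.Divisibility using (_∣_; ∣⇒≤)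
  open import Data.Nat.GCD using (gcd[m,n]∣m)
  open import Data.Fin using (Fin; inject₁; fromℕ; toℕ)
  open import Data.Fin.Properties using (toℕ-inject₁; toℕ-fromℕ; inject₁ℕ<; inject₁-injective)
  open import Data.Fin.Relation.Unary.Top using (view; ‵fromℕ; ‵inject₁)
  open import Data.Sum using (inj₁; inj₂)
  open import Relation.Binary.PropositionalEquality
  open import Relation.Nullary using (contradiction)
  open import Data.Product using (∃; _,_; proj₁)

  x₀ : Fin n → ℕ
  x₀ i = x (inject₁ i)

  below-inject₁ : ∀ k (j : Fin n) → x k ≤ x (inject₁ j) → ∃ λ k′ → k ≡ inject₁ k′
  below-inject₁ k j xₖ≤xⱼ with view k
  ... | ‵fromℕ    = contradiction xₖ≤xⱼ (ℕP.<⇒≱ (x-inc (inject₁ j) (fromℕ n) inject₁j<n))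
    where
    inject₁j<n : toℕ (inject₁ j) < toℕ (fromℕ n)
    inject₁j<n = subst (toℕ (inject₁ j) <_) (sym (toℕ-fromℕ n)) (inject₁ℕ< j)
  ... | ‵inject₁ k′ = k′ , refl

  private
    gtd-inject₁ : ∀ {k j} → IsGTD x k (inject₁ j) → ∃ λ k′ → k ≡ inject₁ k′
    gtd-inject₁ {k} {j} k-gtd = below-inject₁ k j (ℕP.<⇒≤ (proj₁ k-gtd))

    gtd⇒ : ∀ {i j} → IsGTD x₀ i j → IsGTD x (inject₁ i) (inject₁ j)
    gtd⇒ {i} {j} (xᵢ<xⱼ , xᵢ∣xⱼ , maximal) = xᵢ<xⱼ , xᵢ∣xⱼ , maximal′
      where
      maximal′ : ∀ k → x (inject₁ i) ∣ x k → x k ∣ x (inject₁ j) → _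
      maximal′ k xᵢ∣xₖ xₖ∣xⱼ with below-inject₁ k j (∣⇒≤ {{ℕ.>-nonZero (x-pos (inject₁ j))}} xₖ∣xⱼ)
      ... | k′ , refl = maximal k′ xᵢ∣xₖ xₖ∣xⱼ

    gtd⇐ : ∀ {i j} → IsGTD x (inject₁ i) (inject₁ j) → IsGTD x₀ i j
    gtd⇐ (xᵢ<xⱼ , xᵢ∣xⱼ , maximal) = xᵢ<xⱼ , xᵢ∣xⱼ , λ k → maximal (inject₁ k)

  x₀-inc : StrictlyIncreasing x₀
  x₀-inc i j i<j = x-inc (inject₁ i) (inject₁ j) (subst₂ _<_ (sym (toℕ-inject₁ i)) (sym (toℕ-inject₁ j)) i<j)

  x₀-pos : Positive x₀
  x₀-pos i = x-pos (inject₁ i)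

  x₀-gcdClosed : GcdClosed x₀
  x₀-gcdClosed i j with gcd-closed (inject₁ i) (inject₁ j)
  ... | k , xₖ≡gcd with below-inject₁ k i (subst (_≤ x (inject₁ i)) (sym xₖ≡gcd)
                          (∣⇒≤ {{ℕ.>-nonZero (x-pos (inject₁ i))}} (gcd[m,n]∣m (x (inject₁ i)) (x (inject₁ j)))))
  ...   | k′ , refl = k′ , xₖ≡gcd

  x₀-atMostTwo : ∀ j → GAtMostTwo x₀ j
  x₀-atMostTwo j i₁ i₂ i₃ g₁ g₂ g₃ with atMostTwo (inject₁ j) (inject₁ i₁) (inject₁ i₂) (inject₁ i₃) (gtd⇒ g₁) (gtd⇒ g₂) (gtd⇒ g₃)
  ... | inj₁ e        = inj₁ (inject₁-injective e)
  ... | inj₂ (inj₁ e) = inj₂ (inj₁ (inject₁-injective e))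
  ... | inj₂ (inj₂ e) = inj₂ (inj₂ (inject₁-injective e))

  x₀-condG : SetCondG x₀
  x₀-condG j with condG (inject₁ j)
  ... | inj₁ unique = inj₁ (λ i₁ i₂ g₁ g₂ → inject₁-injective (unique (inject₁ i₁) (inject₁ i₂) (gtd⇒ g₁) (gtd⇒ g₂)))
  ... | inj₂ ((y₁ , y₂ , y₁≢y₂ , g₁ , g₂) , condGⱼ) with gtd-inject₁ g₁ | gtd-inject₁ g₂
  ...   | y₁′ , refl | y₂′ , refl = inj₂ ((y₁′ , y₂′ , (λ e → y₁≢y₂ (cong inject₁ e)) , gtd⇐ g₁ , gtd⇐ g₂) , condG₀)
    where
    condG₀ : ElemCondG x₀ j
    condG₀ i₁ i₂ i₁≢i₂ h₁ h₂ with condGⱼ (inject₁ i₁) (inject₁ i₂) (λ e → i₁≢i₂ (inject₁-injective e)) (gtd⇒ h₁) (gtd⇒ h₂)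
    ... | lcm≡ , d , d≡gcd , d-gtd₁ , d-gtd₂ with gtd-inject₁ d-gtd₁
    ...   | d′ , refl = lcm≡ , d′ , d≡gcd , gtd⇐ d-gtd₁ , gtd⇐ d-gtd₂

lemma2p13 : (a b : ℕ) → 0 < a → 0 < b → a ∣ b →
    (n : ℕ) (x : Fin (suc n) → ℕ) →
    StrictlyIncreasing x → Positive x → GcdClosed x → MaxGIsTwo x → SetCondG x →
    let x₀ = λ (i : Fin n) → x (inject₁ i) in
    (MulInvIntegral (gcdMat x b) (gcdMat x a) ⇔ MulInvIntegral (gcdMat x₀ b) (gcdMat x₀ a)) ×
    (MulInvIntegral (lcmMat x b) (gcdMat x a) ⇔ MulInvIntegral (lcmMat x₀ b) (gcdMat x₀ a)) ×
    (MulInvIntegral (lcmMat x b) (lcmMat x a) ⇔ MulInvIntegral (lcmMat x₀ b) (lcmMat x₀ a))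
lemma2p13 a b a>0 b>0 a∣b n x x-inc x-pos gcd-closed (atMostTwo , _) condG =
  both S.gcd-integral S₀.gcd-integral , both S.lcm-gcd-integral S₀.lcm-gcd-integral , both S.lcm-integral S₀.lcm-integral
  where
  open Restriction x x-inc x-pos gcd-closed condG atMostTwo
  module S  = PowerMatrices x  x-inc  x-pos  gcd-closed   condG   atMostTwo   a b a>0 b>0 a∣b
  module S₀ = PowerMatrices x₀ x₀-inc x₀-pos x₀-gcdClosed x₀-condG x₀-atMostTwo a b a>0 b>0 a∣b
  both : ∀ {P Q : Set} → P → Q → P ⇔ Q
  both p q = mk⇔ (λ _ → q) (λ _ → p)
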